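{- Let $(G,L_G)$ be a graft with adjacency matrix $\mathbf{A}$ (over $\mathrm{GF}(2)$). Let $X\subseteq V(G)$. If $\mathbf{A}\ast X$ is defined, denote by $(G',L_{G'})$ the graft with adjacency matrix $\mathbf{A}\ast X$. Then \[ P_{(G,L_G)}^{\langle \delta \rangle}(z)=P_{(G',L_{G'})}^{\langle \delta \rangle}(z). \]
   Context: A graft $(G, L_G)$ consists of a simple graph $G$ together with a vertex subset $L_G \subseteq V(G)$. Its adjacency matrix $\mathbf{A}_{(G,L_G)}$ is the matrix over $\mathrm{GF}(2)$ indexed by $V(G)$ with $(u,v)$-entry $1$ if $u\neq v$ are adjacent, $1$ if $u=v\in L_G$, and $0$ otherwise. For a square matrix $M$ indexed by a finite set $V$ and $A\subseteq V$, $M[A]$ is the principal submatrix on $A$, $A^c=V\setminus A$, and the partial-$\langle\delta\rangle$ polynomial is $P_{\langle \delta \rangle}(M, z) = \sum_{A \subseteq V} z^{\operatorname{rank}(M[A]) + \operatorname{rank}(M[A^c])}$. For a graft, $P_{(G,L_G)}^{\langle \delta \rangle}(z) := P_{\langle \delta \rangle}(\mathbf A_{(G,L_G)}, z)$. For $X \subseteq V$ with $M[X]$ non-singular, the pivot is: writing $M = \begin{pmatrix} P & Q \\ R & S \end{pmatrix}$ with $P = M[X]$, set $M \ast X = \begin{pmatrix} P^{ -1} & -P^{ -1}Q \\ RP^{ -1} & S - RP^{ -1}Q \end{pmatrix}$; $\mathbf{A}\ast X$ is defined exactly when $\mathbf{A}[X]$ is invertible. Over $\mathrm{GF}(2)$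 the pivot of a symmetric matrix is symmetric, so $\mathbf{A}\ast X$ is again the adjacency matrix of a graft. -}

module Defs where

open import Data.Bool using (Bool; true; false; _xor_; _∧_; _∨_; not; if_then_else_)
import Data.Bool as B
open import Data.Product using (_×_)
open import Data.Nat using (ℕ; zero; suc; _+_; _⊔_)
open import Data.Fin using (Fin)
open import Data.Fin.Properties using (_≟_)
open import Data.List using (List; []; _∷_; map; foldr; filter; length; allFin; replicate; zipWith; null; _++_)
open import Data.Vec using (Vec; lookup)
import Data.Vec as V
open import Relation.Nullary.Decidable using (⌊_⌋)
open import Relation.Binary.PropositionalEquality using (_≡_)
import Data.Nat as N

-- GF(2) is represented by Bool (false = 0, true = 1, xor = +, ∧ = ·).

Mat : ℕ → Set
Mat n = Fin n → Fin n → Bool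

record Graft (n : ℕ) : Set where
  field
    adj    : Fin n → Fin n → Bool
    adjSym : ∀ u v → adj u v ≡ adj v u
    adjIrr : ∀ v → adj v v ≡ false
    L      : Fin n → Bool

adjMatrix : ∀ {n} → Graft n → Mat n
adjMatrix g u v =
  if ⌊ u ≟ v ⌋ then Graft.L g u else Graft.adj g u v

Subset : ℕ → Set
Subset n = Vec Bool n

elems : ∀ {n} → Subset n → List (Fin n)
elems A = filter (λ i → lookup A i B.≟ true) (allFin _)

complement : ∀ {n} → Subset n → Subset n
complement = V.map not

allSubsets : ∀ n → List (Subset n)
allSubsets zero = V.[] ∷ []
allSubsets (suc n) =
  map (false V.∷_) (allSubsets n) ++ map (true V.∷_) (allSubsets n)

sumOver : ∀ {n} → Subset n → (Fin n → Bool) → Bool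
sumOver X f = foldr _xor_ false (map f (elems X))

-- Rank over GF(2) of a matrix given as a list of rows (each a list of
-- k entries): the maximum number of linearly independent rows.

sublists : {A : Set} → List A → List (List A)
sublists []       = [] ∷ []
sublists (x ∷ xs) = let s = sublists xs in s ++ map (x ∷_) s

vsum : ℕ → List (List Bool) → List Bool
vsum k = foldr (zipWith _xor_) (replicate k false)

allL : {A : Set} → (A → Bool) → List A → Bool
allL p = foldr (λ x b → p x ∧ b) true

isZeroVec : List Bool → Bool
isZeroVec = allL not

independent : ℕ → List (List Bool) → Bool
independent k S = allL (λ T → null T ∨ not (isZeroVec (vsum k T))) (sublists S)

maximum : List ℕ → ℕ
maximum = foldr _⊔_ 0

rank : ℕ → List (List Bool) → ℕ
rank k rows = maximum (map length (filter (λ S → independent k S B.≟ true) (sublists rows)))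

rankPrincipal : ∀ {n} → Mat n → Subset n → ℕ
rankPrincipal M A =
  rank (length (elems A)) (map (λ u → map (M u) (elems A)) (elems A))

-- The partial-⟨δ⟩ polynomial, represented by its coefficient sequence:
-- coefficient of z^k in Σ_{A ⊆ V} z^{rank M[A] + rank M[A^c]}.

Pδ : ∀ {n} → Mat n → ℕ → ℕ
Pδ {n} M k =
  length (filter (λ A → (rankPrincipal M A + rankPrincipal M (complement A)) N.≟ k)
                 (allSubsets n))

-- Invertibility of M[X]: Q (restricted to X) is a two-sided inverse of M[X].

IsInverseOn : ∀ {n} → Subset n → Mat n → Mat n → Set
IsInverseOn X M Q =
  (∀ u v → lookup X u ≡ true → lookup X v ≡ true →
     sumOver X (λ w → M u w ∧ Q w v) ≡ ⌊ u ≟ v ⌋)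
  ×
  (∀ u v → lookup X u ≡ true → lookup X v ≡ true →
     sumOver X (λ w → Q u w ∧ M w v) ≡ ⌊ u ≟ v ⌋)

-- The pivot M ∗ X, given the inverse Q of P = M[X] (over GF(2), -1 = 1):
--   [P Q; R S] ↦ [P⁻¹  P⁻¹Q ; RP⁻¹  S + RP⁻¹Q]
pivot : ∀ {n} → Mat n → Subset n → Mat n → Mat n
pivot M X Q u v with lookup X u | lookup X v
... | true  | true  = Q u v
... | true  | false = sumOver X (λ w → Q u w ∧ M w v)
... | false | true  = sumOver X (λ w → M u w ∧ Q w v)
... | false | false =
  M u v xor sumOver X (λ w → sumOver X (λ w' → M u w ∧ Q w w' ∧ M w' v))

-- Over GF(2), 2 ^ rank M[A] · |ker M[A]| = 2 ^ |A|, where ker M[A] is the set of x ⊆ A with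
-- x M vanishing on A. For the rank used here (the largest independent subfamily of rows) this
-- follows from a greedy basis: a row outside the span of the later rows enlarges the basis by
-- one, a row inside it doubles the number of subfamilies summing to zero.
-- For N = M ∗ X, replacing the X-coordinates of x by those of x M is a bijection x ↦ x′ with
-- x′ N = x on X and x′ N = x M off X: pivoting exchanges inputs and outputs on X. It carries
-- ker M[A Δ X] onto ker N[A], so |A| − rank N[A] = |A Δ X| − rank M[A Δ X]. Adding this for A
-- and its complement, whose translate is (A Δ X)ᶜ, gives
-- rank N[A] + rank N[Aᶜ] = rank M[A Δ X] + rank M[(A Δ X)ᶜ], and A ↦ A Δ X permutes the subsets.
module Submission where

open import Defs

open import Algebra.Bundles using (CommutativeRing; CommutativeMonoid)
open import Data.Bool using (Bool; true; false; _xor_; _∧_; not; if_then_else_)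
import Data.Bool as Bool
open import Data.Bool.Properties
  using ( xor-assoc; xor-comm; xor-identityˡ; xor-identityʳ; xor-same; not-distribˡ-xor
        ; ∧-assoc; ∧-identityʳ; ∧-zeroʳ; ∧-conicalˡ; ∧-conicalʳ
        ; ∧-commutativeMonoid; xor-∧-commutativeRing )
open import Algebra.Properties.Semiring.Sum (CommutativeRing.semiring xor-∧-commutativeRing)
  using (sum-syntax; sum-cong-≗; sum-replicate-zero; ∑-comm; ∑-distrib-+; *-distribˡ-sum; *-distribʳ-sum)
import Algebra.Properties.CommutativeMonoid.Sum ∧-commutativeMonoid as ⋀
open import Algebra.Properties.CommutativeSemigroup (CommutativeMonoid.commutativeSemigroup ∧-commutativeMonoid)
  using () renaming (x∙yz≈y∙xz to ∧-leftComm)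
open import Data.Nat using (ℕ; zero; suc; _+_; _*_; _^_; _≤_; _≡ᵇ_; z≤n; s≤s; _≟_; ≢-nonZero)
open import Data.Nat.Properties
  using ( module ≤-Reasoning; +-comm; +-identityʳ; +-suc; +-cancelˡ-≡; +-mono-≤; +-monoʳ-≤; m≤m+n
        ; *-assoc; *-comm; *-identityˡ; *-zeroʳ; *-distribˡ-+; *-cancelʳ-≡; *-cancelˡ-≤; *-monoˡ-≤; *-monoʳ-≤
        ; ^-distribˡ-+-*; ^-monoʳ-<; m^n>0; ≤-refl; ≤-reflexive; ≤-trans; ≤-antisym; n≤0⇒n≡0; ≮⇒≥; <⇒≱; <⇒≢
        ; m≤m⊔n; m≤n⊔m; ⊔-lub; +-commutativeSemigroup; *-commutativeSemigroup )
open import Algebra.Properties.CommutativeSemigroup +-commutativeSemigroup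
  using () renaming (interchange to +-interchange)
open import Algebra.Properties.CommutativeSemigroup *-commutativeSemigroup
  using () renaming (x∙yz≈y∙xz to *-leftComm)
open import Data.Fin using (Fin; zero; suc)
import Data.Fin.Properties as Fin
open import Data.List using (List; []; _∷_; _++_; [_]; map; filter; length; foldr; zipWith; null; tabulate; allFin)
open import Data.List.Properties using (map-++; map-∘; map-cong; map-tabulate; length-map; length-tabulate; ++-assoc)
open import Data.List.Membership.Propositional using (_∈_)
open import Data.List.Membership.Propositional.Properties
  using (∈-map⁺; ∈-map⁻; ∈-++⁺ˡ; ∈-++⁺ʳ; ∈-++⁻; ∈-filter⁺; ∈-filter⁻)
open import Data.List.Membership.Propositional.Properties.WithK using (unique∧set⇒bag)
open import Data.List.Relation.Unary.Any using (here; there)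
import Data.List.Relation.Unary.All as All
open import Data.List.Relation.Unary.Unique.Propositional using (Unique) renaming ([] to []ᵘ; _∷_ to _∷ᵘ_)
import Data.List.Relation.Unary.Unique.Propositional.Properties as Unique
open import Data.List.Relation.Binary.BagAndSetEquality using (∼bag⇒↭)
open import Data.List.Relation.Binary.Permutation.Propositional using (_↭_; refl; prep; swap; trans)
open import Data.List.Relation.Binary.Sublist.Propositional using (_⊆_; []; _∷_; _∷ʳ_)
open import Data.Vec using (Vec; []; _∷_; toList)
import Data.Vec as V
import Data.Vec.Properties as V
import Data.Vec.Functional as VF
open VF using (Vector)
open import Data.Empty using (⊥-elim)
open import Data.Product using (∃-syntax; _×_; _,_; proj₁; proj₂)
open import Data.Sum using (inj₁; inj₂)
open import Function using (_∘_; mk⇔)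
open import Relation.Nullary using (does; yes; no; ¬_)
open import Relation.Nullary.Decidable using (does-≡; map′; dec-true; dec-false; isYes≗does)
open import Relation.Nullary.Negation using (contradiction)
open import Relation.Unary using (Decidable)
open import Relation.Binary.PropositionalEquality
  using (_≡_; _≢_; _≗_; refl; sym; cong; cong₂; subst; subst₂; module ≡-Reasoning)
  renaming (trans to ≡-trans)

private variable
  A B : Set
  k n : ℕ

-- Counting

count : (A → Bool) → List A → ℕ
count p []       = 0
count p (x ∷ xs) = if p x then suc (count p xs) else count p xs

count-++ : (p : A → Bool) (xs ys : List A) → count p (xs ++ ys) ≡ count p xs + count p ys
count-++ p []       ys = refl
count-++ p (x ∷ xs) ys with p x
... | true  = cong suc (count-++ p xs ys)
... | false = count-++ p xs ys

count-map : (p : B → Bool) (f : A → B) (xs : List A) → count p (map f xs) ≡ count (p ∘ f) xs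
count-map p f []       = refl
count-map p f (x ∷ xs) with p (f x)
... | true  = cong suc (count-map p f xs)
... | false = count-map p f xs

count-cong : {p q : A → Bool} → p ≗ q → (xs : List A) → count p xs ≡ count q xs
count-cong p≗q []       = refl
count-cong {q = q} p≗q (x ∷ xs) rewrite p≗q x =
  cong (λ c → if q x then suc c else c) (count-cong p≗q xs)

count-false : (xs : List A) → count (λ _ → false) xs ≡ 0
count-false []       = refl
count-false (x ∷ xs) = count-false xs

count-↭ : (p : A → Bool) {xs ys : List A} → xs ↭ ys → count p xs ≡ count p ys
count-↭ p refl          = refl
count-↭ p (prep x xs↭ys) = cong (λ c → if p x then suc c else c) (count-↭ p xs↭ys)
count-↭ p (swap x y xs↭ys) with p x | p y
... | true  | true  = cong (λ c → suc (suc c)) (count-↭ p xs↭ys)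
... | true  | false = cong suc (count-↭ p xs↭ys)
... | false | true  = cong suc (count-↭ p xs↭ys)
... | false | false = count-↭ p xs↭ys
count-↭ p (trans xs↭ys ys↭zs) = ≡-trans (count-↭ p xs↭ys) (count-↭ p ys↭zs)

count≢0⇒∃ : (p : A → Bool) (xs : List A) → count p xs ≢ 0 → ∃[ x ] x ∈ xs × p x ≡ true
count≢0⇒∃ p []       c≢0 = ⊥-elim (c≢0 refl)
count≢0⇒∃ p (x ∷ xs) c≢0 with p x in px
... | true  = x , here refl , px
... | false with count≢0⇒∃ p xs c≢0
...   | y , y∈xs , py = y , there y∈xs , py

count-complement : (p : A → Bool) (xs : List A) → count p xs + count (not ∘ p) xs ≡ length xs
count-complement p []       = refl
count-complement p (x ∷ xs) with p x
... | true  = cong suc (count-complement p xs)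
... | false = ≡-trans (+-suc (count p xs) _) (cong suc (count-complement p xs))

length-filter≡count : {P : A → Set} (P? : Decidable P) (xs : List A) →
  length (filter P? xs) ≡ count (does ∘ P?) xs
length-filter≡count P? []       = refl
length-filter≡count P? (x ∷ xs) with does (P? x)
... | true  = cong suc (length-filter≡count P? xs)
... | false = length-filter≡count P? xs

allL-not≡count≡ᵇ0 : (p : A → Bool) (xs : List A) → allL (not ∘ p) xs ≡ (count p xs ≡ᵇ 0)
allL-not≡count≡ᵇ0 p []       = refl
allL-not≡count≡ᵇ0 p (x ∷ xs) with p x
... | true  = refl
... | false = allL-not≡count≡ᵇ0 p xs

allL-++ : (p : A → Bool) (xs ys : List A) → allL p (xs ++ ys) ≡ allL p xs ∧ allL p ys
allL-++ p []       ys = refl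
allL-++ p (x ∷ xs) ys with p x
... | true  = allL-++ p xs ys
... | false = refl

allL-map : (p : B → Bool) (f : A → B) (xs : List A) → allL p (map f xs) ≡ allL (p ∘ f) xs
allL-map p f []       = refl
allL-map p f (x ∷ xs) = cong (p (f x) ∧_) (allL-map p f xs)

allL-cong : {p q : A → Bool} → p ≗ q → (xs : List A) → allL p xs ≡ allL q xs
allL-cong p≗q []       = refl
allL-cong p≗q (x ∷ xs) = cong₂ _∧_ (p≗q x) (allL-cong p≗q xs)

-- Vectors over GF(2)

infixl 6 _⊕_
infix  4 _==_

_⊕_ : Vec Bool k → Vec Bool k → Vec Bool k
_⊕_ = V.zipWith _xor_

0ᵥ : Vec Bool k
0ᵥ = V.replicate _ false

⊕-assoc : (u v w : Vec Bool k) → u ⊕ v ⊕ w ≡ u ⊕ (v ⊕ w)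
⊕-assoc = V.zipWith-assoc xor-assoc

⊕-comm : (u v : Vec Bool k) → u ⊕ v ≡ v ⊕ u
⊕-comm = V.zipWith-comm xor-comm

⊕-identityˡ : (u : Vec Bool k) → 0ᵥ ⊕ u ≡ u
⊕-identityˡ = V.zipWith-identityˡ xor-identityˡ

⊕-identityʳ : (u : Vec Bool k) → u ⊕ 0ᵥ ≡ u
⊕-identityʳ = V.zipWith-identityʳ xor-identityʳ

⊕-self : (u : Vec Bool k) → u ⊕ u ≡ 0ᵥ
⊕-self []      = refl
⊕-self (b ∷ u) = cong₂ _∷_ (xor-same b) (⊕-self u)

⊕-cancelʳ : (u v : Vec Bool k) → u ⊕ v ⊕ v ≡ u
⊕-cancelʳ u v = begin
  u ⊕ v ⊕ v   ≡⟨ ⊕-assoc u v v ⟩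
  u ⊕ (v ⊕ v) ≡⟨ cong (u ⊕_) (⊕-self v) ⟩
  u ⊕ 0ᵥ      ≡⟨ ⊕-identityʳ u ⟩
  u           ∎
  where open ≡-Reasoning

⊕-cancelˡ : (u v : Vec Bool k) → u ⊕ (u ⊕ v) ≡ v
⊕-cancelˡ u v = begin
  u ⊕ (u ⊕ v) ≡⟨ ⊕-assoc u u v ⟨
  u ⊕ u ⊕ v   ≡⟨ cong (_⊕ v) (⊕-self u) ⟩
  0ᵥ ⊕ v      ≡⟨ ⊕-identityˡ v ⟩
  v           ∎
  where open ≡-Reasoning

⊕-leftComm : (u v w : Vec Bool k) → u ⊕ (v ⊕ w) ≡ v ⊕ (u ⊕ w)
⊕-leftComm u v w = begin
  u ⊕ (v ⊕ w) ≡⟨ ⊕-assoc u v w ⟨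
  u ⊕ v ⊕ w   ≡⟨ cong (_⊕ w) (⊕-comm u v) ⟩
  v ⊕ u ⊕ w   ≡⟨ ⊕-assoc v u w ⟩
  v ⊕ (u ⊕ w) ∎
  where open ≡-Reasoning

⊕-interchange : (u v w x : Vec Bool k) → u ⊕ v ⊕ (w ⊕ x) ≡ u ⊕ w ⊕ (v ⊕ x)
⊕-interchange u v w x = begin
  u ⊕ v ⊕ (w ⊕ x) ≡⟨ ⊕-assoc u v (w ⊕ x) ⟩
  u ⊕ (v ⊕ (w ⊕ x)) ≡⟨ cong (u ⊕_) (⊕-assoc v w x) ⟨
  u ⊕ (v ⊕ w ⊕ x) ≡⟨ cong (λ y → u ⊕ (y ⊕ x)) (⊕-comm v w) ⟩
  u ⊕ (w ⊕ v ⊕ x) ≡⟨ cong (u ⊕_) (⊕-assoc w v x) ⟩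
  u ⊕ (w ⊕ (v ⊕ x)) ≡⟨ ⊕-assoc u w (v ⊕ x) ⟨
  u ⊕ w ⊕ (v ⊕ x) ∎
  where open ≡-Reasoning

⊕-map : (f g : A → Bool) (xs : Vec A k) → V.map f xs ⊕ V.map g xs ≡ V.map (λ a → f a xor g a) xs
⊕-map f g []       = refl
⊕-map f g (x ∷ xs) = cong ((f x xor g x) ∷_) (⊕-map f g xs)

toList-⊕ : (u v : Vec Bool k) → toList (u ⊕ v) ≡ zipWith _xor_ (toList u) (toList v)
toList-⊕ []      []      = refl
toList-⊕ (a ∷ u) (b ∷ v) = cong ((a xor b) ∷_) (toList-⊕ u v)

_==_ : Vec Bool k → Vec Bool k → Bool
u == v = does (V.≡-dec Bool._≟_ u v)

==-sound : {u v : Vec Bool k} → (u == v) ≡ true → u ≡ v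
==-sound {u = u} {v} u==v with V.≡-dec Bool._≟_ u v
... | yes u≡v = u≡v

==-refl : (u : Vec Bool k) → (u == u) ≡ true
==-refl u = dec-true (V.≡-dec Bool._≟_ u u) refl

==-cong : {u v u′ v′ : Vec Bool k} → (u ≡ v → u′ ≡ v′) → (u′ ≡ v′ → u ≡ v) →
  (u == v) ≡ (u′ == v′)
==-cong {u = u} {v} {u′} {v′} to from =
  does-≡ (V.≡-dec Bool._≟_ u v) (map′ from to (V.≡-dec Bool._≟_ u′ v′))

==-⊕ˡ : (u v w : Vec Bool k) → (u ⊕ v == w) ≡ (v == u ⊕ w)
==-⊕ˡ u v w = ==-cong (λ eq → ≡-trans (sym (⊕-cancelˡ u v)) (cong (u ⊕_) eq))
                      (λ eq → ≡-trans (cong (u ⊕_) eq) (⊕-cancelˡ u w))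

==-⊕ʳ : (u v : Vec Bool k) → (u ⊕ v == v) ≡ (u == 0ᵥ)
==-⊕ʳ u v = ==-cong (λ eq → ≡-trans (sym (⊕-cancelʳ u v)) (≡-trans (cong (_⊕ v) eq) (⊕-self v)))
                    (λ eq → ≡-trans (cong (_⊕ v) eq) (⊕-identityˡ v))

xor-cancelˡ : ∀ a b → a xor (b xor a) ≡ b
xor-cancelˡ a b = begin
  a xor (b xor a) ≡⟨ cong (a xor_) (xor-comm b a) ⟩
  a xor (a xor b) ≡⟨ xor-assoc a a b ⟨
  (a xor a) xor b ≡⟨ cong (_xor b) (xor-same a) ⟩
  false xor b     ≡⟨⟩
  b               ∎
  where open ≡-Reasoning

-- Subsets of a finite set

allSubsets-complete : (x : Subset n) → x ∈ allSubsets n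
allSubsets-complete []          = here refl
allSubsets-complete (false ∷ x) = ∈-++⁺ˡ (∈-map⁺ (false ∷_) (allSubsets-complete x))
allSubsets-complete {suc n} (true ∷ x) =
  ∈-++⁺ʳ (map (false ∷_) (allSubsets n)) (∈-map⁺ (true ∷_) (allSubsets-complete x))

allSubsets-unique : ∀ n → Unique (allSubsets n)
allSubsets-unique zero    = All.[] ∷ᵘ []ᵘ
allSubsets-unique (suc n) = Unique.++⁺ (Unique.map⁺ V.∷-injectiveʳ (allSubsets-unique n))
                                       (Unique.map⁺ V.∷-injectiveʳ (allSubsets-unique n))
                                       disjoint
  where
  disjoint : ∀ {x} → ¬ (x ∈ map (false ∷_) (allSubsets n) × x ∈ map (true ∷_) (allSubsets n))
  disjoint (x∈₀ , x∈₁) with ∈-map⁻ (false ∷_) x∈₀ | ∈-map⁻ (true ∷_) x∈₁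
  ... | _ , _ , refl | _ , _ , ()

count-bijection : (φ ψ : Subset n → Subset n) → (∀ x → ψ (φ x) ≡ x) → (∀ y → φ (ψ y) ≡ y) →
  (p : Subset n → Bool) → count (p ∘ φ) (allSubsets n) ≡ count p (allSubsets n)
count-bijection {n} φ ψ ψφ φψ p = begin
  count (p ∘ φ) U   ≡⟨ count-map p φ U ⟨
  count p (map φ U) ≡⟨ count-↭ p (∼bag⇒↭ (unique∧set⇒bag φ-unique U-unique same-elements)) ⟩
  count p U         ∎
  where
  open ≡-Reasoning
  U = allSubsets n
  U-unique = allSubsets-unique n
  φ-injective : ∀ {x y} → φ x ≡ φ y → x ≡ y
  φ-injective {x} {y} φx≡φy = ≡-trans (sym (ψφ x)) (≡-trans (cong ψ φx≡φy) (ψφ y))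
  φ-unique = Unique.map⁺ φ-injective U-unique
  same-elements = λ {y} → mk⇔ (λ _ → allSubsets-complete y)
                              (λ _ → subst (_∈ map φ U) (φψ y) (∈-map⁺ φ (allSubsets-complete (ψ y))))

count-allSubsets-suc : (p : Subset (suc n) → Bool) →
  count p (allSubsets (suc n))
    ≡ count (p ∘ (false ∷_)) (allSubsets n) + count (p ∘ (true ∷_)) (allSubsets n)
count-allSubsets-suc {n} p = ≡-trans (count-++ p (map (false ∷_) S) (map (true ∷_) S))
                                     (cong₂ _+_ (count-map p (false ∷_) S) (count-map p (true ∷_) S))
  where S = allSubsets n

complement-⊕ : (A X : Subset n) → complement (A ⊕ X) ≡ complement A ⊕ X
complement-⊕ []      []      = refl
complement-⊕ (a ∷ A) (x ∷ X) = cong₂ _∷_ (not-distribˡ-xor a x) (complement-⊕ A X)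

filter-map : {P : B → Set} (P? : Decidable P) (f : A → B) (xs : List A) →
  filter P? (map f xs) ≡ map f (filter (P? ∘ f) xs)
filter-map P? f []       = refl
filter-map P? f (x ∷ xs) with does (P? (f x))
... | true  = cong (f x ∷_) (filter-map P? f xs)
... | false = filter-map P? f xs

elems-∷-suc : (b : Bool) (x : Subset n) →
  filter (λ i → V.lookup (b ∷ x) i Bool.≟ true) (tabulate suc) ≡ map suc (elems x)
elems-∷-suc {n} b x = ≡-trans (cong (filter ∈bx?) (sym (map-tabulate (λ i → i) suc)))
                              (filter-map ∈bx? suc (allFin n))
  where ∈bx? = λ i → V.lookup (b ∷ x) i Bool.≟ true

elems-∷ : (b : Bool) (x : Subset n) →
  elems (b ∷ x) ≡ (if b then zero ∷ map suc (elems x) else map suc (elems x))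
elems-∷ true  x = cong (zero ∷_) (elems-∷-suc true x)
elems-∷ false x = elems-∷-suc false x

size : Subset n → ℕ
size A = length (elems A)

size≡count : (A : Subset n) → size A ≡ count (V.lookup A) (allFin n)
size≡count {n} A = ≡-trans (length-filter≡count (λ i → V.lookup A i Bool.≟ true) (allFin n))
                           (count-cong (λ i → does-≟true (V.lookup A i)) (allFin n))
  where
  does-≟true : ∀ b → does (b Bool.≟ true) ≡ b
  does-≟true true  = refl
  does-≟true false = refl

size-complement : (A : Subset n) → size A + size (complement A) ≡ n
size-complement {n} A = begin
  size A + size (complement A)
    ≡⟨ cong₂ _+_ (size≡count A) (size≡count (complement A)) ⟩
  count (V.lookup A) (allFin n) + count (V.lookup (complement A)) (allFin n)
    ≡⟨ cong (count (V.lookup A) (allFin n) +_) (count-cong (λ i → V.lookup-map i not A) (allFin n)) ⟩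
  count (V.lookup A) (allFin n) + count (not ∘ V.lookup A) (allFin n)
    ≡⟨ count-complement (V.lookup A) (allFin n) ⟩
  length (allFin n)
    ≡⟨ length-tabulate (λ i → i) ⟩
  n ∎
  where open ≡-Reasoning

size-complement-⊕ : (A X : Subset n) → size (A ⊕ X) + size (complement A ⊕ X) ≡ n
size-complement-⊕ A X =
  ≡-trans (cong (λ B → size (A ⊕ X) + size B) (sym (complement-⊕ A X))) (size-complement (A ⊕ X))

infix 4 _⊆ᵇ_

_⊆ᵇ_ : Subset n → Subset n → Bool
[]      ⊆ᵇ []      = true
(a ∷ x) ⊆ᵇ (b ∷ y) = (if a then b else true) ∧ (x ⊆ᵇ y)

-- Rank and nullity of a family of vectors

-- Families of rows are lists of fixed-length vectors, on which ⊕ is a group law; rank on lists of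
-- lists is recovered through toList (rank-toList).
sumᵥ : List (Vec Bool k) → Vec Bool k
sumᵥ = foldr _⊕_ 0ᵥ

select : (R : List A) → Subset (length R) → List A
select []      []      = []
select (r ∷ R) (b ∷ m) = if b then r ∷ select R m else select R m

sublists-select : (R : List A) → sublists R ≡ map (select R) (allSubsets (length R))
sublists-select []      = refl
sublists-select (r ∷ R) = begin
  sublists R ++ map (r ∷_) (sublists R)
    ≡⟨ cong (λ s → s ++ map (r ∷_) s) (sublists-select R) ⟩
  map (select R) S ++ map (r ∷_) (map (select R) S)
    ≡⟨ cong₂ _++_ (map-∘ {g = select (r ∷ R)} {f = false ∷_} S)
                  (≡-trans (sym (map-∘ S)) (map-∘ {g = select (r ∷ R)} {f = true ∷_} S)) ⟩
  map (select (r ∷ R)) (map (false ∷_) S) ++ map (select (r ∷ R)) (map (true ∷_) S)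
    ≡⟨ map-++ (select (r ∷ R)) (map (false ∷_) S) (map (true ∷_) S) ⟨
  map (select (r ∷ R)) (allSubsets (length (r ∷ R))) ∎
  where
  open ≡-Reasoning
  S = allSubsets (length R)

scale : Bool → Vec Bool k → Vec Bool k
scale b u = if b then u else 0ᵥ

scale-xor : ∀ b c (u : Vec Bool k) → scale (b xor c) u ≡ scale b u ⊕ scale c u
scale-xor false false u = sym (⊕-identityˡ 0ᵥ)
scale-xor false true  u = sym (⊕-identityˡ u)
scale-xor true  false u = sym (⊕-identityʳ u)
scale-xor true  true  u = sym (⊕-self u)

sumᵥ-select-∷ : (r : Vec Bool k) (R : List (Vec Bool k)) (b : Bool) (m : Subset (length R)) →
  sumᵥ (select (r ∷ R) (b ∷ m)) ≡ scale b r ⊕ sumᵥ (select R m)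
sumᵥ-select-∷ r R true  m = refl
sumᵥ-select-∷ r R false m = sym (⊕-identityˡ _)

sumᵥ-select-⊕ : (R : List (Vec Bool k)) (m m′ : Subset (length R)) →
  sumᵥ (select R (m ⊕ m′)) ≡ sumᵥ (select R m) ⊕ sumᵥ (select R m′)
sumᵥ-select-⊕ []      []      []       = sym (⊕-identityˡ 0ᵥ)
sumᵥ-select-⊕ (r ∷ R) (b ∷ m) (c ∷ m′) = begin
  sumᵥ (select (r ∷ R) ((b xor c) ∷ (m ⊕ m′)))
    ≡⟨ sumᵥ-select-∷ r R (b xor c) (m ⊕ m′) ⟩
  scale (b xor c) r ⊕ sumᵥ (select R (m ⊕ m′))
    ≡⟨ cong₂ _⊕_ (scale-xor b c r) (sumᵥ-select-⊕ R m m′) ⟩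
  scale b r ⊕ scale c r ⊕ (sumᵥ (select R m) ⊕ sumᵥ (select R m′))
    ≡⟨ ⊕-interchange _ _ _ _ ⟩
  scale b r ⊕ sumᵥ (select R m) ⊕ (scale c r ⊕ sumᵥ (select R m′))
    ≡⟨ cong₂ _⊕_ (sumᵥ-select-∷ r R b m) (sumᵥ-select-∷ r R c m′) ⟨
  sumᵥ (select (r ∷ R) (b ∷ m)) ⊕ sumᵥ (select (r ∷ R) (c ∷ m′)) ∎
  where open ≡-Reasoning

-- fibre 0ᵥ R is the size of the left kernel of the matrix with rows R.
fibre : Vec Bool k → List (Vec Bool k) → ℕ
fibre v R = count (λ T → sumᵥ T == v) (sublists R)

fibre-masks : (v : Vec Bool k) (R : List (Vec Bool k)) →
  fibre v R ≡ count (λ m → sumᵥ (select R m) == v) (allSubsets (length R))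
fibre-masks v R = ≡-trans (cong (count (λ T → sumᵥ T == v)) (sublists-select R))
                          (count-map (λ T → sumᵥ T == v) (select R) (allSubsets (length R)))

fibre-∷ : (v r : Vec Bool k) (R : List (Vec Bool k)) → fibre v (r ∷ R) ≡ fibre v R + fibre (r ⊕ v) R
fibre-∷ v r R = begin
  count q (sublists R ++ map (r ∷_) (sublists R))
    ≡⟨ count-++ q (sublists R) _ ⟩
  fibre v R + count q (map (r ∷_) (sublists R))
    ≡⟨ cong (fibre v R +_) (count-map q (r ∷_) (sublists R)) ⟩
  fibre v R + count (λ T → r ⊕ sumᵥ T == v) (sublists R)
    ≡⟨ cong (fibre v R +_) (count-cong (λ T → ==-⊕ˡ r (sumᵥ T) v) (sublists R)) ⟩
  fibre v R + fibre (r ⊕ v) R ∎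
  where
  open ≡-Reasoning
  q = λ T → sumᵥ T == v

fibre₀-∷ : (r : Vec Bool k) (R : List (Vec Bool k)) → fibre 0ᵥ (r ∷ R) ≡ fibre 0ᵥ R + fibre r R
fibre₀-∷ r R = ≡-trans (fibre-∷ 0ᵥ r R) (cong (λ v → fibre 0ᵥ R + fibre v R) (⊕-identityʳ r))

fibre₀-[] : fibre {k} 0ᵥ [] ≡ 1
fibre₀-[] {k} = cong (λ b → if b then 1 else 0) (==-refl (0ᵥ {k}))

fibre-coset : (v : Vec Bool k) (R : List (Vec Bool k)) → fibre v R ≢ 0 → fibre v R ≡ fibre 0ᵥ R
-- Translating by a subfamily m₀ with sum v matches the subfamilies with sum v to those with sum 0ᵥ.
fibre-coset v R fibre≢0
  with count≢0⇒∃ _ (allSubsets (length R)) (subst (_≢ 0) (fibre-masks v R) fibre≢0)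
... | m₀ , _ , m₀↦v = begin
  fibre v R
    ≡⟨ fibre-masks v R ⟩
  count (λ m → sumᵥ (select R m) == v) U
    ≡⟨ count-bijection (_⊕ m₀) (_⊕ m₀) (λ m → ⊕-cancelʳ m m₀) (λ m → ⊕-cancelʳ m m₀) _ ⟨
  count (λ m → sumᵥ (select R (m ⊕ m₀)) == v) U
    ≡⟨ count-cong translate U ⟩
  count (λ m → sumᵥ (select R m) == 0ᵥ) U
    ≡⟨ fibre-masks 0ᵥ R ⟨
  fibre 0ᵥ R ∎
  where
  open ≡-Reasoning
  U = allSubsets (length R)
  translate : ∀ m → (sumᵥ (select R (m ⊕ m₀)) == v) ≡ (sumᵥ (select R m) == 0ᵥ)
  translate m = ≡-trans (cong (_== v) (≡-trans (sumᵥ-select-⊕ R m m₀) (cong (_ ⊕_) (==-sound m₀↦v))))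
                        (==-⊕ʳ (sumᵥ (select R m)) v)

fibre≤fibre₀ : (v : Vec Bool k) (R : List (Vec Bool k)) → fibre v R ≤ fibre 0ᵥ R
fibre≤fibre₀ v R with fibre v R ≟ 0
... | yes fibre≡0 = subst (_≤ fibre 0ᵥ R) (sym fibre≡0) z≤n
... | no  fibre≢0 = ≤-reflexive (fibre-coset v R fibre≢0)

fibre-insert : (v r : Vec Bool k) (P R : List (Vec Bool k)) →
  fibre v (P ++ r ∷ R) ≡ fibre v (P ++ R) + fibre (r ⊕ v) (P ++ R)
fibre-insert v r []      R = fibre-∷ v r R
fibre-insert v r (p ∷ P) R = begin
  fibre v (p ∷ P ++ r ∷ R)
    ≡⟨ fibre-∷ v p (P ++ r ∷ R) ⟩
  fibre v (P ++ r ∷ R) + fibre (p ⊕ v) (P ++ r ∷ R)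
    ≡⟨ cong₂ _+_ (fibre-insert v r P R) (fibre-insert (p ⊕ v) r P R) ⟩
  fibre v Q + fibre (r ⊕ v) Q + (fibre (p ⊕ v) Q + fibre (r ⊕ (p ⊕ v)) Q)
    ≡⟨ cong (λ w → fibre v Q + fibre (r ⊕ v) Q + (fibre (p ⊕ v) Q + fibre w Q))
            (⊕-leftComm r p v) ⟩
  fibre v Q + fibre (r ⊕ v) Q + (fibre (p ⊕ v) Q + fibre (p ⊕ (r ⊕ v)) Q)
    ≡⟨ +-interchange (fibre v Q) _ _ _ ⟩
  fibre v Q + fibre (p ⊕ v) Q + (fibre (r ⊕ v) Q + fibre (p ⊕ (r ⊕ v)) Q)
    ≡⟨ cong₂ _+_ (fibre-∷ v p Q) (fibre-∷ (r ⊕ v) p Q) ⟨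
  fibre v (p ∷ Q) + fibre (r ⊕ v) (p ∷ Q) ∎
  where
  open ≡-Reasoning
  Q = P ++ R

fibre₀-insert-≤ : (r : Vec Bool k) (P R : List (Vec Bool k)) →
  fibre 0ᵥ (P ++ r ∷ R) ≤ 2 * fibre 0ᵥ (P ++ R)
fibre₀-insert-≤ r P R = begin
  fibre 0ᵥ Q′                  ≡⟨ fibre-insert 0ᵥ r P R ⟩
  fibre 0ᵥ Q + fibre (r ⊕ 0ᵥ) Q ≤⟨ +-monoʳ-≤ (fibre 0ᵥ Q) (fibre≤fibre₀ (r ⊕ 0ᵥ) Q) ⟩
  fibre 0ᵥ Q + fibre 0ᵥ Q       ≡⟨ cong (fibre 0ᵥ Q +_) (+-identityʳ _) ⟨
  2 * fibre 0ᵥ Q               ∎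
  where
  open ≤-Reasoning
  Q  = P ++ R
  Q′ = P ++ r ∷ R

fibre-mono : {S R : List (Vec Bool k)} → S ⊆ R → (v : Vec Bool k) → fibre v S ≤ fibre v R
fibre-mono []                       v = ≤-refl
fibre-mono {S = S} {R = _ ∷ R} (r ∷ʳ S⊆R) v = begin
  fibre v S                   ≤⟨ fibre-mono S⊆R v ⟩
  fibre v R                   ≤⟨ m≤m+n _ _ ⟩
  fibre v R + fibre (r ⊕ v) R ≡⟨ fibre-∷ v r R ⟨
  fibre v (r ∷ R)             ∎
  where open ≤-Reasoning
fibre-mono {S = r ∷ S} {R = _ ∷ R} (refl ∷ S⊆R) v = begin
  fibre v (r ∷ S)             ≡⟨ fibre-∷ v r S ⟩
  fibre v S + fibre (r ⊕ v) S ≤⟨ +-mono-≤ (fibre-mono S⊆R v) (fibre-mono S⊆R (r ⊕ v)) ⟩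
  fibre v R + fibre (r ⊕ v) R ≡⟨ fibre-∷ v r R ⟨
  fibre v (r ∷ R)             ∎
  where open ≤-Reasoning

-- Each row of R skipped by S at most doubles fibre 0ᵥ (fibre₀-insert-≤); the prefix P lets the
-- induction insert that row in the middle of the list.
sublist-bound : {S R : List (Vec Bool k)} → S ⊆ R → (P : List (Vec Bool k)) →
  fibre 0ᵥ (P ++ R) * 2 ^ length S ≤ fibre 0ᵥ (P ++ S) * 2 ^ length R
sublist-bound []                            P = ≤-refl
sublist-bound {S = S} {R = _ ∷ R} (r ∷ʳ S⊆R) P = begin
  fibre 0ᵥ (P ++ r ∷ R) * 2 ^ length S       ≤⟨ *-monoˡ-≤ (2 ^ length S) (fibre₀-insert-≤ r P R) ⟩
  2 * fibre 0ᵥ (P ++ R) * 2 ^ length S       ≡⟨ *-assoc 2 (fibre 0ᵥ (P ++ R)) (2 ^ length S) ⟩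
  2 * (fibre 0ᵥ (P ++ R) * 2 ^ length S)     ≤⟨ *-monoʳ-≤ 2 (sublist-bound S⊆R P) ⟩
  2 * (fibre 0ᵥ (P ++ S) * 2 ^ length R)     ≡⟨ *-leftComm 2 (fibre 0ᵥ (P ++ S)) (2 ^ length R) ⟩
  fibre 0ᵥ (P ++ S) * 2 ^ length (r ∷ R)     ∎
  where open ≤-Reasoning
sublist-bound {S = r ∷ S} {R = _ ∷ R} (refl ∷ S⊆R) P = begin
  fibre 0ᵥ (P ++ r ∷ R) * (2 * 2 ^ length S)   ≡⟨ *-leftComm (fibre 0ᵥ (P ++ r ∷ R)) 2 (2 ^ length S) ⟩
  2 * (fibre 0ᵥ (P ++ r ∷ R) * 2 ^ length S)   ≤⟨ *-monoʳ-≤ 2 moved ⟩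
  2 * (fibre 0ᵥ (P ++ r ∷ S) * 2 ^ length R)   ≡⟨ *-leftComm 2 (fibre 0ᵥ (P ++ r ∷ S)) (2 ^ length R) ⟩
  fibre 0ᵥ (P ++ r ∷ S) * (2 * 2 ^ length R)   ∎
  where
  open ≤-Reasoning
  moved : fibre 0ᵥ (P ++ r ∷ R) * 2 ^ length S ≤ fibre 0ᵥ (P ++ r ∷ S) * 2 ^ length R
  moved = subst₂ (λ X Y → fibre 0ᵥ X * 2 ^ length S ≤ fibre 0ᵥ Y * 2 ^ length R)
                 (++-assoc P [ r ] R) (++-assoc P [ r ] S) (sublist-bound S⊆R (P ++ [ r ]))

∈-sublists⇒⊆ : {T R : List A} → T ∈ sublists R → T ⊆ R
∈-sublists⇒⊆ {R = []}    (here refl) = []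
∈-sublists⇒⊆ {R = r ∷ R} T∈ with ∈-++⁻ (sublists R) T∈
... | inj₁ T∈ˡ = r ∷ʳ ∈-sublists⇒⊆ T∈ˡ
... | inj₂ T∈ʳ with ∈-map⁻ (r ∷_) T∈ʳ
...   | T′ , T′∈ , refl = refl ∷ ∈-sublists⇒⊆ T′∈

sublists-map : (f : A → B) (L : List A) → sublists (map f L) ≡ map (map f) (sublists L)
sublists-map f []      = refl
sublists-map f (x ∷ L) = begin
  sublists (map f L) ++ map (f x ∷_) (sublists (map f L))
    ≡⟨ cong (λ s → s ++ map (f x ∷_) s) (sublists-map f L) ⟩
  map (map f) S ++ map (f x ∷_) (map (map f) S)
    ≡⟨ cong (map (map f) S ++_) (≡-trans (sym (map-∘ S)) (map-∘ S)) ⟩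
  map (map f) S ++ map (map f) (map (x ∷_) S)
    ≡⟨ map-++ (map f) S (map (x ∷_) S) ⟨
  map (map f) (S ++ map (x ∷_) S) ∎
  where
  open ≡-Reasoning
  S = sublists L

vsum-toList : (T : List (Vec Bool k)) → vsum k (map toList T) ≡ toList (sumᵥ T)
vsum-toList {k} []      = sym (V.toList-replicate k false)
vsum-toList     (u ∷ T) = ≡-trans (cong (zipWith _xor_ (toList u)) (vsum-toList T))
                                  (sym (toList-⊕ u (sumᵥ T)))

isZeroVec-toList : (u : Vec Bool k) → isZeroVec (toList u) ≡ (u == 0ᵥ)
isZeroVec-toList []          = refl
isZeroVec-toList (true  ∷ u) = refl
isZeroVec-toList (false ∷ u) = isZeroVec-toList u

independent-∷ : (r : Vec Bool k) (S : List (Vec Bool k)) →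
  independent k (map toList (r ∷ S)) ≡ independent k (map toList S) ∧ (fibre r S ≡ᵇ 0)
independent-∷ {k} r S = begin
  allL p (L ++ map (toList r ∷_) L)
    ≡⟨ allL-++ p L (map (toList r ∷_) L) ⟩
  independent k (map toList S) ∧ allL p (map (toList r ∷_) L)
    ≡⟨ cong (independent k (map toList S) ∧_) (begin
         allL p (map (toList r ∷_) L)
           ≡⟨ allL-map p (toList r ∷_) L ⟩
         allL (p ∘ (toList r ∷_)) L
           ≡⟨ cong (allL (p ∘ (toList r ∷_))) (sublists-map toList S) ⟩
         allL (p ∘ (toList r ∷_)) (map (map toList) (sublists S))
           ≡⟨ allL-map (p ∘ (toList r ∷_)) (map toList) (sublists S) ⟩
         allL (p ∘ (toList r ∷_) ∘ map toList) (sublists S)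
           ≡⟨ allL-cong extend (sublists S) ⟩
         allL (not ∘ (λ T → sumᵥ T == r)) (sublists S)
           ≡⟨ allL-not≡count≡ᵇ0 (λ T → sumᵥ T == r) (sublists S) ⟩
         (fibre r S ≡ᵇ 0) ∎) ⟩
  independent k (map toList S) ∧ (fibre r S ≡ᵇ 0) ∎
  where
  open ≡-Reasoning
  p = λ T → null T Bool.∨ not (isZeroVec (vsum k T))
  L = sublists (map toList S)
  extend : ∀ T → p (toList r ∷ map toList T) ≡ not (sumᵥ T == r)
  extend T = cong not (begin
    isZeroVec (zipWith _xor_ (toList r) (vsum k (map toList T)))
      ≡⟨ cong (λ w → isZeroVec (zipWith _xor_ (toList r) w)) (vsum-toList T) ⟩
    isZeroVec (zipWith _xor_ (toList r) (toList (sumᵥ T)))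
      ≡⟨ cong isZeroVec (toList-⊕ r (sumᵥ T)) ⟨
    isZeroVec (toList (r ⊕ sumᵥ T))
      ≡⟨ isZeroVec-toList (r ⊕ sumᵥ T) ⟩
    (r ⊕ sumᵥ T == 0ᵥ)
      ≡⟨ ==-⊕ˡ r (sumᵥ T) 0ᵥ ⟩
    (sumᵥ T == r ⊕ 0ᵥ)
      ≡⟨ cong (sumᵥ T ==_) (⊕-identityʳ r) ⟩
    (sumᵥ T == r) ∎)

≡ᵇ0⇒≡0 : ∀ n → (n ≡ᵇ 0) ≡ true → n ≡ 0
≡ᵇ0⇒≡0 zero _ = refl

independent⇒fibre₀≡1 : (S : List (Vec Bool k)) → independent k (map toList S) ≡ true → fibre 0ᵥ S ≡ 1
independent⇒fibre₀≡1 {k} []      _           = fibre₀-[] {k}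
independent⇒fibre₀≡1     (r ∷ S) independent = begin
  fibre 0ᵥ (r ∷ S)       ≡⟨ fibre₀-∷ r S ⟩
  fibre 0ᵥ S + fibre r S ≡⟨ cong₂ _+_ (independent⇒fibre₀≡1 S (∧-conicalˡ _ _ split))
                                      (≡ᵇ0⇒≡0 (fibre r S) (∧-conicalʳ _ _ split)) ⟩
  1 + 0                  ∎
  where
  open ≡-Reasoning
  split = ≡-trans (sym (independent-∷ r S)) independent

basis : List (Vec Bool k) → List (Vec Bool k)
basis []      = []
basis (r ∷ R) with fibre r R ≟ 0
... | yes _ = r ∷ basis R
... | no  _ = basis R

basis-∈ : (R : List (Vec Bool k)) → basis R ∈ sublists R
basis-∈ []      = here refl
basis-∈ (r ∷ R) with fibre r R ≟ 0
... | yes _ = ∈-++⁺ʳ (sublists R) (∈-map⁺ (r ∷_) (basis-∈ R))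
... | no  _ = ∈-++⁺ˡ (basis-∈ R)

basis-independent : (R : List (Vec Bool k)) → independent k (map toList (basis R)) ≡ true
basis-independent []      = refl
basis-independent (r ∷ R) with fibre r R ≟ 0
... | no  _       = basis-independent R
... | yes fibre≡0 = ≡-trans (independent-∷ r (basis R))
                            (cong₂ _∧_ (basis-independent R) (cong (_≡ᵇ 0) r∉span))
  where
  r∉span : fibre r (basis R) ≡ 0
  r∉span = n≤0⇒n≡0 (subst (fibre r (basis R) ≤_) fibre≡0
                            (fibre-mono (∈-sublists⇒⊆ {R = R} (basis-∈ R)) r))

fibre₀-basis : (R : List (Vec Bool k)) → 2 ^ length (basis R) * fibre 0ᵥ R ≡ 2 ^ length R
fibre₀-basis {k} []      = cong (1 *_) (fibre₀-[] {k})
fibre₀-basis     (r ∷ R) with fibre r R ≟ 0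
... | yes fibre≡0 = begin
  2 * b * fibre 0ᵥ (r ∷ R)       ≡⟨ cong (2 * b *_) (fibre₀-∷ r R) ⟩
  2 * b * (fibre 0ᵥ R + fibre r R) ≡⟨ cong (λ c → 2 * b * (fibre 0ᵥ R + c)) fibre≡0 ⟩
  2 * b * (fibre 0ᵥ R + 0) ≡⟨ cong (2 * b *_) (+-identityʳ _) ⟩
  2 * b * fibre 0ᵥ R       ≡⟨ *-assoc 2 b (fibre 0ᵥ R) ⟩
  2 * (b * fibre 0ᵥ R)     ≡⟨ cong (2 *_) (fibre₀-basis R) ⟩
  2 * 2 ^ length R         ∎
  where
  open ≡-Reasoning
  b = 2 ^ length (basis R)
... | no fibre≢0 = begin
  b * fibre 0ᵥ (r ∷ R)            ≡⟨ cong (b *_) (fibre₀-∷ r R) ⟩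
  b * (fibre 0ᵥ R + fibre r R)    ≡⟨ cong (λ c → b * (fibre 0ᵥ R + c)) (fibre-coset r R fibre≢0) ⟩
  b * (fibre 0ᵥ R + fibre 0ᵥ R)   ≡⟨ *-distribˡ-+ b (fibre 0ᵥ R) (fibre 0ᵥ R) ⟩
  b * fibre 0ᵥ R + b * fibre 0ᵥ R ≡⟨ cong₂ _+_ (fibre₀-basis R) (fibre₀-basis R) ⟩
  2 ^ length R + 2 ^ length R     ≡⟨ cong (2 ^ length R +_) (+-identityʳ _) ⟨
  2 * 2 ^ length R                ∎
  where
  open ≡-Reasoning
  b = 2 ^ length (basis R)

fibre₀≢0 : (R : List (Vec Bool k)) → fibre 0ᵥ R ≢ 0
fibre₀≢0 R fibre≡0 = <⇒≢ (m^n>0 2 (length R)) (sym (begin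
  2 ^ length R                        ≡⟨ fibre₀-basis R ⟨
  2 ^ length (basis R) * fibre 0ᵥ R   ≡⟨ cong (2 ^ length (basis R) *_) fibre≡0 ⟩
  2 ^ length (basis R) * 0            ≡⟨ *-zeroʳ (2 ^ length (basis R)) ⟩
  0                                   ∎))
  where open ≡-Reasoning

2^-cancel-≤ : ∀ {a b} → 2 ^ a ≤ 2 ^ b → a ≤ b
2^-cancel-≤ 2^a≤2^b = ≮⇒≥ (λ b<a → <⇒≱ (^-monoʳ-< 2 (s≤s (s≤s z≤n)) b<a) 2^a≤2^b)

2^-injective : ∀ {a b} → 2 ^ a ≡ 2 ^ b → a ≡ b
2^-injective eq = ≤-antisym (2^-cancel-≤ (≤-reflexive eq)) (2^-cancel-≤ (≤-reflexive (sym eq)))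

independent-length≤basis : {S R : List (Vec Bool k)} → S ⊆ R → independent k (map toList S) ≡ true →
  length S ≤ length (basis R)
independent-length≤basis {S = S} {R} S⊆R independent = 2^-cancel-≤ (*-cancelˡ-≤ (fibre 0ᵥ R) (begin
  fibre 0ᵥ R * 2 ^ length S           ≤⟨ sublist-bound S⊆R [] ⟩
  fibre 0ᵥ S * 2 ^ length R           ≡⟨ cong (_* 2 ^ length R) (independent⇒fibre₀≡1 S independent) ⟩
  1 * 2 ^ length R                    ≡⟨ *-identityˡ _ ⟩
  2 ^ length R                        ≡⟨ fibre₀-basis R ⟨
  2 ^ length (basis R) * fibre 0ᵥ R   ≡⟨ *-comm _ (fibre 0ᵥ R) ⟩
  fibre 0ᵥ R * 2 ^ length (basis R)   ∎))
  where
  open ≤-Reasoning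
  instance _ = ≢-nonZero (fibre₀≢0 R)

maximum≡ : {m : ℕ} {L : List ℕ} → m ∈ L → (∀ {x} → x ∈ L → x ≤ m) → maximum L ≡ m
maximum≡ m∈L bound = ≤-antisym (maximum≤ _ bound) (≤maximum m∈L)
  where
  maximum≤ : ∀ {m} L → (∀ {x} → x ∈ L → x ≤ m) → maximum L ≤ m
  maximum≤ []      bound = z≤n
  maximum≤ (x ∷ L) bound = ⊔-lub (bound (here refl)) (maximum≤ L (bound ∘ there))
  ≤maximum : ∀ {x L} → x ∈ L → x ≤ maximum L
  ≤maximum (here refl)   = m≤m⊔n _ _
  ≤maximum (there {x = y} x∈L) = ≤-trans (≤maximum x∈L) (m≤n⊔m y _)

rank-toList : (R : List (Vec Bool k)) → rank k (map toList R) ≡ length (basis R)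
rank-toList {k} R = maximum≡ basis-length∈ bound
  where
  independent? = λ S → independent k S Bool.≟ true
  subfamilies = sublists (map toList R)
  as-vectors : ∀ {S} → S ∈ subfamilies → ∃[ S′ ] S′ ∈ sublists R × S ≡ map toList S′
  as-vectors S∈ = ∈-map⁻ (map toList) (subst (_ ∈_) (sublists-map toList R) S∈)
  basis-length∈ : length (basis R) ∈ map length (filter independent? subfamilies)
  basis-length∈ = subst (_∈ map length (filter independent? subfamilies)) (length-map toList (basis R))
    (∈-map⁺ length (∈-filter⁺ independent?
      (subst (map toList (basis R) ∈_) (sym (sublists-map toList R)) (∈-map⁺ (map toList) (basis-∈ R)))
      (basis-independent R)))
  bound : ∀ {x} → x ∈ map length (filter independent? subfamilies) → x ≤ length (basis R)
  bound x∈ with ∈-map⁻ length x∈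
  ... | S , S∈ , refl with ∈-filter⁻ independent? S∈
  ...   | S∈subfamilies , independent with as-vectors S∈subfamilies
  ...     | S′ , S′∈ , refl = subst (_≤ length (basis R)) (sym (length-map toList S′))
                                (independent-length≤basis (∈-sublists⇒⊆ {R = R} S′∈) independent)

rank-nullity : (R : List (Vec Bool k)) → 2 ^ rank k (map toList R) * fibre 0ᵥ R ≡ 2 ^ length R
rank-nullity R = ≡-trans (cong (λ r → 2 ^ r * fibre 0ᵥ R) (rank-toList R)) (fibre₀-basis R)

-- Kernels of principal submatrices

count-sublists-map : (q : List B → Bool) (f : A → B) (L : List A) →
  count q (sublists (map f L)) ≡ count (q ∘ map f) (sublists L)
count-sublists-map q f L = ≡-trans (cong (count q) (sublists-map f L)) (count-map q (map f) (sublists L))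

count-sublists-elems : (q : List (Fin n) → Bool) (A : Subset n) →
  count q (sublists (elems A)) ≡ count (λ x → (x ⊆ᵇ A) ∧ q (elems x)) (allSubsets n)
count-sublists-elems q [] = refl
count-sublists-elems {suc n} q (b ∷ A) = begin
  count q (sublists (elems (b ∷ A)))
    ≡⟨ split b ⟩
  F + count (λ x → (b ∧ (x ⊆ᵇ A)) ∧ q (elems (true ∷ x))) S
    ≡⟨ count-allSubsets-suc (λ x → (x ⊆ᵇ b ∷ A) ∧ q (elems x)) ⟨
  count (λ x → (x ⊆ᵇ b ∷ A) ∧ q (elems x)) (allSubsets (suc n)) ∎
  where
  open ≡-Reasoning
  S = allSubsets n
  E = elems A
  F = count (λ x → (x ⊆ᵇ A) ∧ q (elems (false ∷ x))) S
  shift : (q′ : List (Fin (suc n)) → Bool) (c : Bool) (tail : List (Fin (suc n)) → List (Fin (suc n))) →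
    (∀ x → elems (c ∷ x) ≡ tail (map suc (elems x))) →
    count (q′ ∘ tail) (sublists (map suc E)) ≡ count (λ x → (x ⊆ᵇ A) ∧ q′ (elems (c ∷ x))) S
  shift q′ c tail elems≡ = begin
    count (q′ ∘ tail) (sublists (map suc E))
      ≡⟨ count-sublists-map (q′ ∘ tail) suc E ⟩
    count (q′ ∘ tail ∘ map suc) (sublists E)
      ≡⟨ count-sublists-elems (q′ ∘ tail ∘ map suc) A ⟩
    count (λ x → (x ⊆ᵇ A) ∧ q′ (tail (map suc (elems x)))) S
      ≡⟨ count-cong (λ x → cong (λ l → (x ⊆ᵇ A) ∧ q′ l) (elems≡ x)) S ⟨
    count (λ x → (x ⊆ᵇ A) ∧ q′ (elems (c ∷ x))) S ∎
  split : ∀ b → count q (sublists (elems (b ∷ A)))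
                  ≡ F + count (λ x → (b ∧ (x ⊆ᵇ A)) ∧ q (elems (true ∷ x))) S
  split false = begin
    count q (sublists (elems (false ∷ A)))
      ≡⟨ cong (count q ∘ sublists) (elems-∷ false A) ⟩
    count q (sublists (map suc E))
      ≡⟨ shift q false (λ l → l) (elems-∷ false) ⟩
    F
      ≡⟨ +-identityʳ F ⟨
    F + 0
      ≡⟨ cong (F +_) (count-false S) ⟨
    F + count (λ _ → false) S ∎
  split true = begin
    count q (sublists (elems (true ∷ A)))
      ≡⟨ cong (count q ∘ sublists) (elems-∷ true A) ⟩
    count q (sublists (map suc E) ++ map (zero ∷_) (sublists (map suc E)))
      ≡⟨ count-++ q (sublists (map suc E)) (map (zero ∷_) (sublists (map suc E))) ⟩
    count q (sublists (map suc E)) + count q (map (zero ∷_) (sublists (map suc E)))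
      ≡⟨ cong (count q (sublists (map suc E)) +_) (count-map q (zero ∷_) (sublists (map suc E))) ⟩
    count q (sublists (map suc E)) + count (q ∘ (zero ∷_)) (sublists (map suc E))
      ≡⟨ cong₂ _+_ (shift q false (λ l → l) (elems-∷ false)) (shift q true (zero ∷_) (elems-∷ true)) ⟩
    F + count (λ x → (x ⊆ᵇ A) ∧ q (elems (true ∷ x))) S ∎

rows : Mat n → (A : Subset n) → List (Vec Bool (length (elems A)))
rows M A = map (λ u → V.map (M u) (V.fromList (elems A))) (elems A)

rankPrincipal-rows : (M : Mat n) (A : Subset n) →
  rankPrincipal M A ≡ rank (length (elems A)) (map toList (rows M A))
rankPrincipal-rows M A = cong (rank (length E)) (begin
  map (λ u → map (M u) E) E
    ≡⟨ map-cong (λ u → sym (≡-trans (V.toList-map (M u) (V.fromList E))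
                                    (cong (map (M u)) (V.toList∘fromList E)))) E ⟩
  map (toList ∘ (λ u → V.map (M u) (V.fromList E))) E
    ≡⟨ map-∘ E ⟩
  map toList (rows M A) ∎)
  where
  open ≡-Reasoning
  E = elems A

inKernel : Mat n → Subset n → Subset n → Bool
inKernel M A x = (x ⊆ᵇ A) ∧ allL (λ w → not (sumOver x (λ u → M u w))) (elems A)

kernelCount : Mat n → Subset n → ℕ
kernelCount {n} M A = count (inKernel M A) (allSubsets n)

sumᵥ-rows : (M : Mat n) (E T : List (Fin n)) →
  sumᵥ (map (λ u → V.map (M u) (V.fromList E)) T)
    ≡ V.map (λ w → foldr _xor_ false (map (λ u → M u w) T)) (V.fromList E)
sumᵥ-rows M E []      = sym (V.map-const (V.fromList E) false)
sumᵥ-rows M E (u ∷ T) = ≡-trans (cong (V.map (M u) (V.fromList E) ⊕_) (sumᵥ-rows M E T))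
                                (⊕-map (M u) _ (V.fromList E))

map-fromList==0ᵥ : (g : A → Bool) (E : List A) → (V.map g (V.fromList E) == 0ᵥ) ≡ allL (not ∘ g) E
map-fromList==0ᵥ g []      = refl
map-fromList==0ᵥ g (e ∷ E) with g e
... | true  = refl
... | false = map-fromList==0ᵥ g E

fibre₀-rows : (M : Mat n) (A : Subset n) → fibre 0ᵥ (rows M A) ≡ kernelCount M A
fibre₀-rows M A = begin
  count (λ T → sumᵥ T == 0ᵥ) (sublists (map row E))
    ≡⟨ count-sublists-map (λ T → sumᵥ T == 0ᵥ) row E ⟩
  count (λ T → sumᵥ (map row T) == 0ᵥ) (sublists E)
    ≡⟨ count-cong (λ T → ≡-trans (cong (_== 0ᵥ) (sumᵥ-rows M E T)) (map-fromList==0ᵥ (columnSum T) E))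
                  (sublists E) ⟩
  count (λ T → allL (not ∘ columnSum T) E) (sublists E)
    ≡⟨ count-sublists-elems (λ T → allL (not ∘ columnSum T) E) A ⟩
  kernelCount M A ∎
  where
  open ≡-Reasoning
  E = elems A
  row = λ u → V.map (M u) (V.fromList E)
  columnSum = λ T w → foldr _xor_ false (map (λ u → M u w) T)

principal-rank-nullity : (M : Mat n) (A : Subset n) → 2 ^ rankPrincipal M A * kernelCount M A ≡ 2 ^ size A
principal-rank-nullity M A = begin
  2 ^ rankPrincipal M A * kernelCount M A
    ≡⟨ cong₂ (λ r c → 2 ^ r * c) (rankPrincipal-rows M A) (sym (fibre₀-rows M A)) ⟩
  2 ^ rank (length (elems A)) (map toList (rows M A)) * fibre 0ᵥ (rows M A)
    ≡⟨ rank-nullity (rows M A) ⟩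
  2 ^ length (rows M A)
    ≡⟨ cong (2 ^_) (length-map _ (elems A)) ⟩
  2 ^ size A ∎
  where open ≡-Reasoning

kernelCount≢0 : (M : Mat n) (A : Subset n) → kernelCount M A ≢ 0
kernelCount≢0 M A = subst (_≢ 0) (fibre₀-rows M A) (fibre₀≢0 (rows M A))

equal-kernels⇒equal-nullity : (M N : Mat n) (A B : Subset n) → kernelCount N A ≡ kernelCount M B →
  rankPrincipal N A + size B ≡ size A + rankPrincipal M B
equal-kernels⇒equal-nullity M N A B same-kernel = 2^-injective (*-cancelʳ-≡ _ _ K (begin
  2 ^ (rN + size B) * K       ≡⟨ cong (_* K) (^-distribˡ-+-* 2 rN (size B)) ⟩
  2 ^ rN * 2 ^ size B * K     ≡⟨ cong (_* K) (*-comm (2 ^ rN) (2 ^ size B)) ⟩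
  2 ^ size B * 2 ^ rN * K     ≡⟨ *-assoc (2 ^ size B) (2 ^ rN) K ⟩
  2 ^ size B * (2 ^ rN * K)   ≡⟨ cong (2 ^ size B *_) (principal-rank-nullity N A) ⟩
  2 ^ size B * 2 ^ size A     ≡⟨ *-comm (2 ^ size B) (2 ^ size A) ⟩
  2 ^ size A * 2 ^ size B     ≡⟨ cong (2 ^ size A *_) (principal-rank-nullity M B) ⟨
  2 ^ size A * (2 ^ rM * K′)  ≡⟨ cong (λ c → 2 ^ size A * (2 ^ rM * c)) same-kernel ⟨
  2 ^ size A * (2 ^ rM * K)   ≡⟨ *-assoc (2 ^ size A) (2 ^ rM) K ⟨
  2 ^ size A * 2 ^ rM * K     ≡⟨ cong (_* K) (^-distribˡ-+-* 2 (size A) rM) ⟨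
  2 ^ (size A + rM) * K       ∎))
  where
  open ≡-Reasoning
  rN = rankPrincipal N A
  rM = rankPrincipal M B
  K  = kernelCount N A
  K′ = kernelCount M B
  instance _ = ≢-nonZero (kernelCount≢0 N A)

-- Matrix algebra over GF(2)

-- Unlike ⌊_⌋ (used in IsInverseOn), does makes δ (suc u) (suc v) reduce to δ u v.
δ : Fin n → Fin n → Bool
δ u v = does (u Fin.≟ v)

δ-≢ : {v w : Fin n} → v ≢ w → δ v w ≡ false
δ-≢ {v = v} {w} v≢w = dec-false (v Fin.≟ w) v≢w

∈-∉-distinct : (X : Subset n) {v w : Fin n} → V.lookup X v ≡ true → V.lookup X w ≡ false → v ≢ w
∈-∉-distinct X v∈X w∉X refl = contradiction (≡-trans (sym v∈X) w∉X) λ ()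

∑-δˡ : (v : Fin n) (f : Vector Bool n) → ∑[ w < n ] (δ v w ∧ f w) ≡ f v
∑-δˡ {suc n} zero    f = ≡-trans (cong (f zero xor_) (sum-replicate-zero n)) (xor-identityʳ (f zero))
∑-δˡ {suc n} (suc v) f = ∑-δˡ v (f ∘ suc)

∑-δʳ : (v : Fin n) (f : Vector Bool n) → ∑[ w < n ] (f w ∧ δ w v) ≡ f v
∑-δʳ {suc n} zero    f = begin
  (f zero ∧ true) xor ∑[ w < n ] (f (suc w) ∧ false)
    ≡⟨ cong₂ _xor_ (∧-identityʳ (f zero)) (sum-cong-≗ (∧-zeroʳ ∘ f ∘ suc)) ⟩
  f zero xor ∑[ w < n ] false
    ≡⟨ cong (f zero xor_) (sum-replicate-zero n) ⟩
  f zero xor false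
    ≡⟨ xor-identityʳ (f zero) ⟩
  f zero ∎
  where open ≡-Reasoning
∑-δʳ {suc n} (suc v) f =
  ≡-trans (cong (_xor ∑[ w < n ] (f (suc w) ∧ δ (suc w) (suc v))) (∧-zeroʳ (f zero)))
          (∑-δʳ v (f ∘ suc))

infixl 7 _·_ _*ₘ_
infixl 8 _↾_

_·_ : Vector Bool n → Mat n → Vector Bool n
(x · A) i = ∑[ u < _ ] (x u ∧ A u i)

_*ₘ_ : Mat n → Mat n → Mat n
(A *ₘ B) v = A v · B

·-congˡ : {x y : Vector Bool n} → x ≗ y → (A : Mat n) → x · A ≗ y · A
·-congˡ x≗y A i = sum-cong-≗ (λ u → cong (_∧ A u i) (x≗y u))

·-congʳ : (x : Vector Bool n) (A B : Mat n) {i : Fin n} →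
  (∀ v → A v i ≡ B v i) → (x · A) i ≡ (x · B) i
·-congʳ x A B A≡B = sum-cong-≗ (λ u → cong (x u ∧_) (A≡B u))

·-assoc : (x : Vector Bool n) (A B : Mat n) → (x · A) · B ≗ x · (A *ₘ B)
·-assoc {n} x A B i = begin
  ∑[ u < n ] (∑[ v < n ] (x v ∧ A v u) ∧ B u i)
    ≡⟨ sum-cong-≗ (λ u → *-distribʳ-sum (B u i) (λ v → x v ∧ A v u)) ⟩
  ∑[ u < n ] ∑[ v < n ] ((x v ∧ A v u) ∧ B u i)
    ≡⟨ ∑-comm (λ u v → (x v ∧ A v u) ∧ B u i) ⟩
  ∑[ v < n ] ∑[ u < n ] ((x v ∧ A v u) ∧ B u i)
    ≡⟨ sum-cong-≗ (λ v → ≡-trans (sum-cong-≗ (λ u → ∧-assoc (x v) (A v u) (B u i)))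
                                   (sym (*-distribˡ-sum (x v) (λ u → A v u ∧ B u i)))) ⟩
  ∑[ v < n ] (x v ∧ ∑[ u < n ] (A v u ∧ B u i)) ∎
  where open ≡-Reasoning

·-δ : (x : Vector Bool n) → x · δ ≗ x
·-δ x i = ∑-δʳ i x

·-if : (x : Vector Bool n) (c : Vector Bool n) (A B : Mat n) (i : Fin n) →
  (x · (λ v j → if c j then A v j else B v j)) i ≡ (if c i then (x · A) i else (x · B) i)
·-if x c A B i with c i
... | true  = refl
... | false = refl

_↾_ : Vector Bool n → Subset n → Vector Bool n
(x ↾ X) w = V.lookup X w ∧ x w

↾-· : (y : Vector Bool n) (B : Mat n) (X : Subset n) → (y · B) ↾ X ≗ y · (λ w → B w ↾ X)
↾-· y B X i = ≡-trans (*-distribˡ-sum (V.lookup X i) (λ w → y w ∧ B w i))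
                      (sum-cong-≗ (λ w → ∧-leftComm (V.lookup X i) (y w) (B w i)))

_*[_]_ : Mat n → Subset n → Mat n → Mat n
(A *[ X ] B) v = A v ↾ X · B

*[]-assoc : (A B C : Mat n) (X : Subset n) (v : Fin n) →
  ((A *[ X ] B) *[ X ] C) v ≗ (A *[ X ] (B *[ X ] C)) v
*[]-assoc A B C X v i = ≡-trans (·-congˡ (↾-· (A v ↾ X) B X) C i)
                                (·-assoc (A v ↾ X) (λ w → B w ↾ X) C i)

*[]-congˡ : (X : Subset n) (A A′ B : Mat n) {v : Fin n} →
  (∀ w → V.lookup X w ≡ true → A v w ≡ A′ v w) → ∀ i → (A *[ X ] B) v i ≡ (A′ *[ X ] B) v i
*[]-congˡ X A A′ B {v} A≡A′ i = sum-cong-≗ entries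
  where
  entries : ∀ w → (V.lookup X w ∧ A v w) ∧ B w i ≡ (V.lookup X w ∧ A′ v w) ∧ B w i
  entries w with V.lookup X w in w∈X
  ... | true  = cong (_∧ B w i) (A≡A′ w w∈X)
  ... | false = refl

*[]-congʳ : (X : Subset n) (A B B′ : Mat n) {i : Fin n} →
  (∀ w → V.lookup X w ≡ true → B w i ≡ B′ w i) → ∀ v → (A *[ X ] B) v i ≡ (A *[ X ] B′) v i
*[]-congʳ X A B B′ {i} B≡B′ v = sum-cong-≗ entries
  where
  entries : ∀ w → (V.lookup X w ∧ A v w) ∧ B w i ≡ (V.lookup X w ∧ A v w) ∧ B′ w i
  entries w with V.lookup X w in w∈X
  ... | true  = cong (A v w ∧_) (B≡B′ w w∈X)
  ... | false = refl

*[]-δˡ : (X : Subset n) (D C : Mat n) {v : Fin n} → V.lookup X v ≡ true →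
  (∀ w → V.lookup X w ≡ true → D v w ≡ δ v w) → ∀ i → (D *[ X ] C) v i ≡ C v i
*[]-δˡ X D C {v} v∈X D≡δ i = ≡-trans (·-congˡ masked C i) (∑-δˡ v (λ w → C w i))
  where
  masked : D v ↾ X ≗ δ v
  masked w with V.lookup X w in w∈X
  ... | true  = D≡δ w w∈X
  ... | false = sym (δ-≢ (∈-∉-distinct X v∈X w∈X))

*[]-δʳ : (X : Subset n) (A D : Mat n) {i : Fin n} → V.lookup X i ≡ true →
  (∀ w → V.lookup X w ≡ true → D w i ≡ δ w i) → ∀ v → (A *[ X ] D) v i ≡ A v i
*[]-δʳ X A D {i} i∈X D≡δ v = ≡-trans (sum-cong-≗ masked) (∑-δʳ i (A v))
  where
  masked : ∀ w → (V.lookup X w ∧ A v w) ∧ D w i ≡ A v w ∧ δ w i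
  masked w with V.lookup X w in w∈X
  ... | true  = cong (A v w ∧_) (D≡δ w w∈X)
  ... | false = ≡-trans (sym (∧-zeroʳ (A v w)))
                        (cong (A v w ∧_) (sym (δ-≢ (∈-∉-distinct X i∈X w∈X ∘ sym))))

exchange : Subset n → Mat n → Mat n
exchange X A v u = if V.lookup X u then A v u else δ v u

exchange-apply : (X : Subset n) (A : Mat n) (x : Vector Bool n) (i : Fin n) →
  (x · exchange X A) i ≡ (if V.lookup X i then (x · A) i else x i)
exchange-apply X A x i = ≡-trans (·-if x (V.lookup X) A δ i)
                                 (cong (if V.lookup X i then (x · A) i else_) (·-δ x i))

exchange-apply-∈ : (X : Subset n) (A : Mat n) (x : Vector Bool n) {i : Fin n} →
  V.lookup X i ≡ true → (x · exchange X A) i ≡ (x · A) i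
exchange-apply-∈ X A x {i} i∈X =
  ≡-trans (exchange-apply X A x i) (cong (λ b → if b then (x · A) i else x i) i∈X)

exchange-apply-∉ : (X : Subset n) (A : Mat n) (x : Vector Bool n) {i : Fin n} →
  V.lookup X i ≡ false → (x · exchange X A) i ≡ x i
exchange-apply-∉ X A x {i} i∉X =
  ≡-trans (exchange-apply X A x i) (cong (λ b → if b then (x · A) i else x i) i∉X)

exchange-*ₘ : (X : Subset n) (A B : Mat n) (v i : Fin n) →
  (exchange X A *ₘ B) v i ≡ (A *[ X ] B) v i xor (not (V.lookup X v) ∧ B v i)
exchange-*ₘ {n} X A B v i = begin
  ∑[ u < n ] (exchange X A v u ∧ B u i)
    ≡⟨ sum-cong-≗ split ⟩
  ∑[ u < n ] (inside u xor outside u)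
    ≡⟨ ∑-distrib-+ inside outside ⟩
  (A *[ X ] B) v i xor ∑[ u < n ] (δ v u ∧ (not (V.lookup X u) ∧ B u i))
    ≡⟨ cong ((A *[ X ] B) v i xor_) (∑-δˡ v (λ u → not (V.lookup X u) ∧ B u i)) ⟩
  (A *[ X ] B) v i xor (not (V.lookup X v) ∧ B v i) ∎
  where
  open ≡-Reasoning
  inside outside : Vector Bool n
  inside  u = (V.lookup X u ∧ A v u) ∧ B u i
  outside u = δ v u ∧ (not (V.lookup X u) ∧ B u i)
  split : ∀ u → exchange X A v u ∧ B u i ≡ inside u xor outside u
  split u with V.lookup X u
  ... | true  = sym (≡-trans (cong ((A v u ∧ B u i) xor_) (∧-zeroʳ (δ v u))) (xor-identityʳ _))
  ... | false = refl

exchange-*ₘ-∈ : (X : Subset n) (A B : Mat n) {v : Fin n} → V.lookup X v ≡ true →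
  ∀ i → (exchange X A *ₘ B) v i ≡ (A *[ X ] B) v i
exchange-*ₘ-∈ X A B {v} v∈X i =
  ≡-trans (exchange-*ₘ X A B v i)
          (≡-trans (cong (λ b → (A *[ X ] B) v i xor (not b ∧ B v i)) v∈X) (xor-identityʳ _))

exchange-*ₘ-∉ : (X : Subset n) (A B : Mat n) {v : Fin n} → V.lookup X v ≡ false →
  ∀ i → (exchange X A *ₘ B) v i ≡ (A *[ X ] B) v i xor B v i
exchange-*ₘ-∉ X A B {v} v∉X i =
  ≡-trans (exchange-*ₘ X A B v i) (cong (λ b → (A *[ X ] B) v i xor (not b ∧ B v i)) v∉X)

-- Kernel vectors coordinatewise

foldr-elems : {C : Set} (_∙_ : C → C → C) (e : C) → (∀ c → e ∙ c ≡ c) →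
  (f : Fin n → C) (x : Subset n) →
  foldr _∙_ e (map f (elems x)) ≡ VF.foldr _∙_ e (λ i → if V.lookup x i then f i else e)
foldr-elems _∙_ e identityˡ f []          = refl
foldr-elems _∙_ e identityˡ f (true ∷ x)  = begin
  foldr _∙_ e (map f (elems (true ∷ x)))
    ≡⟨ cong (foldr _∙_ e ∘ map f) (elems-∷ true x) ⟩
  f zero ∙ foldr _∙_ e (map f (map suc (elems x)))
    ≡⟨ cong (λ l → f zero ∙ foldr _∙_ e l) (map-∘ (elems x)) ⟨
  f zero ∙ foldr _∙_ e (map (f ∘ suc) (elems x))
    ≡⟨ cong (f zero ∙_) (foldr-elems _∙_ e identityˡ (f ∘ suc) x) ⟩
  f zero ∙ VF.foldr _∙_ e (λ i → if V.lookup x i then f (suc i) else e) ∎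
  where open ≡-Reasoning
foldr-elems _∙_ e identityˡ f (false ∷ x) = begin
  foldr _∙_ e (map f (elems (false ∷ x)))
    ≡⟨ cong (foldr _∙_ e ∘ map f) (elems-∷ false x) ⟩
  foldr _∙_ e (map f (map suc (elems x)))
    ≡⟨ cong (foldr _∙_ e) (map-∘ (elems x)) ⟨
  foldr _∙_ e (map (f ∘ suc) (elems x))
    ≡⟨ foldr-elems _∙_ e identityˡ (f ∘ suc) x ⟩
  VF.foldr _∙_ e (λ i → if V.lookup x i then f (suc i) else e)
    ≡⟨ identityˡ _ ⟨
  e ∙ VF.foldr _∙_ e (λ i → if V.lookup x i then f (suc i) else e) ∎
  where open ≡-Reasoning

sumOver-∑ : (X : Subset n) (f : Vector Bool n) → sumOver X f ≡ ∑[ w < n ] (V.lookup X w ∧ f w)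
sumOver-∑ X f = ≡-trans (foldr-elems _xor_ false xor-identityˡ f X) (sum-cong-≗ if-false)
  where
  if-false : ∀ w → (if V.lookup X w then f w else false) ≡ V.lookup X w ∧ f w
  if-false w with V.lookup X w
  ... | true  = refl
  ... | false = refl

sumOver-*[] : (X : Subset n) (A B : Mat n) (u v : Fin n) → sumOver X (λ w → A u w ∧ B w v) ≡ (A *[ X ] B) u v
sumOver-*[] X A B u v = ≡-trans (sumOver-∑ X (λ w → A u w ∧ B w v))
                                (sum-cong-≗ (λ w → sym (∧-assoc (V.lookup X w) (A u w) (B w v))))

allL-elems : (p : Vector Bool n) (x : Subset n) →
  allL p (elems x) ≡ ⋀.sum (λ i → if V.lookup x i then p i else true)
allL-elems p x = ≡-trans (allL-foldr (elems x)) (foldr-elems _∧_ true (λ _ → refl) p x)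
  where
  allL-foldr : ∀ xs → allL p xs ≡ foldr _∧_ true (map p xs)
  allL-foldr []       = refl
  allL-foldr (x ∷ xs) = cong (p x ∧_) (allL-foldr xs)

⊆ᵇ-pointwise : (x A : Subset n) →
  (x ⊆ᵇ A) ≡ ⋀.sum (λ i → if V.lookup x i then V.lookup A i else true)
⊆ᵇ-pointwise []      []      = refl
⊆ᵇ-pointwise (a ∷ x) (b ∷ A) = cong ((if a then b else true) ∧_) (⊆ᵇ-pointwise x A)

-- The condition of inKernel K A x at one coordinate i, with a = x i, z = A i and s = (x · K) i.
kernelAt : Bool → Bool → Bool → Bool
kernelAt a z s = (if a then z else true) ∧ (if z then not s else true)

kernelAt-cong : ∀ {a a′ z z′ s s′} → a ≡ a′ → z ≡ z′ → s ≡ s′ →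
  kernelAt a z s ≡ kernelAt a′ z′ s′
kernelAt-cong refl refl refl = refl

kernelAt-swap : ∀ a z s → kernelAt a z s ≡ kernelAt s (not z) a
kernelAt-swap true  true  true  = refl
kernelAt-swap true  true  false = refl
kernelAt-swap true  false true  = refl
kernelAt-swap true  false false = refl
kernelAt-swap false true  true  = refl
kernelAt-swap false true  false = refl
kernelAt-swap false false true  = refl
kernelAt-swap false false false = refl

inKernel-pointwise : (K : Mat n) (A x : Subset n) →
  inKernel K A x ≡ ⋀.sum (λ i → kernelAt (V.lookup x i) (V.lookup A i) ((V.lookup x · K) i))
inKernel-pointwise K A x = begin
  (x ⊆ᵇ A) ∧ allL (λ w → not (sumOver x (λ u → K u w))) (elems A)
    ≡⟨ cong₂ _∧_ (⊆ᵇ-pointwise x A) (allL-elems (λ w → not (sumOver x (λ u → K u w))) A) ⟩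
  ⋀.sum (λ i → if V.lookup x i then V.lookup A i else true)
    ∧ ⋀.sum (λ i → if V.lookup A i then not (sumOver x (λ u → K u i)) else true)
    ≡⟨ ⋀.∑-distrib-+ (λ i → if V.lookup x i then V.lookup A i else true) _ ⟨
  ⋀.sum (λ i → kernelAt (V.lookup x i) (V.lookup A i) (sumOver x (λ u → K u i)))
    ≡⟨ ⋀.sum-cong-≗ (λ i → cong (kernelAt (V.lookup x i) (V.lookup A i))
                                (sumOver-∑ x (λ u → K u i))) ⟩
  ⋀.sum (λ i → kernelAt (V.lookup x i) (V.lookup A i) ((V.lookup x · K) i)) ∎
  where open ≡-Reasoning

-- Pivoting

module Pivot {n : ℕ} (M N Q : Mat n) (X : Subset n) (inverse : IsInverseOn X M Q)
             (N≡pivot : ∀ u v → N u v ≡ pivot M X Q u v) where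

  M*Q≡δ : {u v : Fin n} → V.lookup X u ≡ true → V.lookup X v ≡ true → (M *[ X ] Q) u v ≡ δ u v
  M*Q≡δ {u} {v} u∈X v∈X =
    ≡-trans (sym (sumOver-*[] X M Q u v))
            (≡-trans (proj₁ inverse u v u∈X v∈X) (isYes≗does (u Fin.≟ v)))

  Q*M≡δ : {u v : Fin n} → V.lookup X u ≡ true → V.lookup X v ≡ true → (Q *[ X ] M) u v ≡ δ u v
  Q*M≡δ {u} {v} u∈X v∈X =
    ≡-trans (sym (sumOver-*[] X Q M u v))
            (≡-trans (proj₂ inverse u v u∈X v∈X) (isYes≗does (u Fin.≟ v)))

  N-XX : {u v : Fin n} → V.lookup X u ≡ true → V.lookup X v ≡ true → N u v ≡ Q u v
  N-XX {u} {v} u∈X v∈X = ≡-trans (N≡pivot u v) block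
    where
    block : pivot M X Q u v ≡ Q u v
    block rewrite u∈X | v∈X = refl

  N-XY : {u v : Fin n} → V.lookup X u ≡ true → V.lookup X v ≡ false → N u v ≡ (Q *[ X ] M) u v
  N-XY {u} {v} u∈X v∉X = ≡-trans (N≡pivot u v) (≡-trans block (sumOver-*[] X Q M u v))
    where
    block : pivot M X Q u v ≡ sumOver X (λ w → Q u w ∧ M w v)
    block rewrite u∈X | v∉X = refl

  N-YX : {u v : Fin n} → V.lookup X u ≡ false → V.lookup X v ≡ true → N u v ≡ (M *[ X ] Q) u v
  N-YX {u} {v} u∉X v∈X = ≡-trans (N≡pivot u v) (≡-trans block (sumOver-*[] X M Q u v))
    where
    block : pivot M X Q u v ≡ sumOver X (λ w → M u w ∧ Q w v)
    block rewrite u∉X | v∈X = refl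

  N-YY : {u v : Fin n} → V.lookup X u ≡ false → V.lookup X v ≡ false →
    N u v ≡ M u v xor (M *[ X ] (Q *[ X ] M)) u v
  N-YY {u} {v} u∉X v∉X = ≡-trans (N≡pivot u v) (≡-trans block (cong (M u v xor_) double-sum))
    where
    block : pivot M X Q u v ≡ M u v xor sumOver X (λ w → sumOver X (λ w′ → M u w ∧ Q w w′ ∧ M w′ v))
    block rewrite u∉X | v∉X = refl
    inner : ∀ w → sumOver X (λ w′ → M u w ∧ Q w w′ ∧ M w′ v) ≡ M u w ∧ (Q *[ X ] M) w v
    inner w = begin
      sumOver X (λ w′ → M u w ∧ Q w w′ ∧ M w′ v)
        ≡⟨ sumOver-∑ X (λ w′ → M u w ∧ Q w w′ ∧ M w′ v) ⟩
      ∑[ w′ < n ] (V.lookup X w′ ∧ M u w ∧ Q w w′ ∧ M w′ v)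
        ≡⟨ sum-cong-≗ (λ w′ → ≡-trans (∧-leftComm (V.lookup X w′) (M u w) _)
                                      (cong (M u w ∧_) (sym (∧-assoc _ (Q w w′) (M w′ v))))) ⟩
      ∑[ w′ < n ] (M u w ∧ ((V.lookup X w′ ∧ Q w w′) ∧ M w′ v))
        ≡⟨ *-distribˡ-sum (M u w) (λ w′ → (V.lookup X w′ ∧ Q w w′) ∧ M w′ v) ⟨
      M u w ∧ (Q *[ X ] M) w v ∎
      where open ≡-Reasoning
    double-sum : sumOver X (λ w → sumOver X (λ w′ → M u w ∧ Q w w′ ∧ M w′ v))
                   ≡ (M *[ X ] (Q *[ X ] M)) u v
    double-sum = ≡-trans (sumOver-∑ X _)
                         (sum-cong-≗ (λ w → ≡-trans (cong (V.lookup X w ∧_) (inner w))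
                                                    (sym (∧-assoc (V.lookup X w) (M u w) _))))

  exchange-M*N-∈ : {i : Fin n} → V.lookup X i ≡ true → ∀ v → (exchange X M *ₘ N) v i ≡ δ v i
  exchange-M*N-∈ {i} i∈X v with V.lookup X v in v∈X
  ... | true  = begin
    (exchange X M *ₘ N) v i ≡⟨ exchange-*ₘ-∈ X M N v∈X i ⟩
    (M *[ X ] N) v i        ≡⟨ *[]-congʳ X M N Q (λ w w∈X → N-XX w∈X i∈X) v ⟩
    (M *[ X ] Q) v i        ≡⟨ M*Q≡δ v∈X i∈X ⟩
    δ v i                   ∎
    where open ≡-Reasoning
  ... | false = begin
    (exchange X M *ₘ N) v i               ≡⟨ exchange-*ₘ-∉ X M N v∈X i ⟩
    (M *[ X ] N) v i xor N v i            ≡⟨ cong₂ _xor_ (*[]-congʳ X M N Q (λ w w∈X → N-XX w∈X i∈X) v)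
                                                         (N-YX v∈X i∈X) ⟩
    (M *[ X ] Q) v i xor (M *[ X ] Q) v i ≡⟨ xor-same ((M *[ X ] Q) v i) ⟩
    false                                 ≡⟨ δ-≢ (∈-∉-distinct X i∈X v∈X ∘ sym) ⟨
    δ v i                                 ∎
    where open ≡-Reasoning

  exchange-M*N-∉ : {i : Fin n} → V.lookup X i ≡ false → ∀ v → (exchange X M *ₘ N) v i ≡ M v i
  exchange-M*N-∉ {i} i∉X v with V.lookup X v in v∈X
  ... | true  = begin
    (exchange X M *ₘ N) v i     ≡⟨ exchange-*ₘ-∈ X M N v∈X i ⟩
    (M *[ X ] N) v i            ≡⟨ *[]-congʳ X M N (Q *[ X ] M) (λ w w∈X → N-XY w∈X i∉X) v ⟩
    (M *[ X ] (Q *[ X ] M)) v i ≡⟨ *[]-assoc M Q M X v i ⟨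
    ((M *[ X ] Q) *[ X ] M) v i ≡⟨ *[]-δˡ X (M *[ X ] Q) M v∈X (λ w w∈X → M*Q≡δ v∈X w∈X) i ⟩
    M v i                       ∎
    where open ≡-Reasoning
  ... | false = begin
    (exchange X M *ₘ N) v i
      ≡⟨ exchange-*ₘ-∉ X M N v∈X i ⟩
    (M *[ X ] N) v i xor N v i
      ≡⟨ cong₂ _xor_ (*[]-congʳ X M N (Q *[ X ] M) (λ w w∈X → N-XY w∈X i∉X) v) (N-YY v∈X i∉X) ⟩
    (M *[ X ] (Q *[ X ] M)) v i xor (M v i xor (M *[ X ] (Q *[ X ] M)) v i)
      ≡⟨ xor-cancelˡ ((M *[ X ] (Q *[ X ] M)) v i) (M v i) ⟩
    M v i ∎
    where open ≡-Reasoning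

  exchange-N*M-∈ : {i : Fin n} → V.lookup X i ≡ true → ∀ u → (exchange X N *ₘ M) u i ≡ δ u i
  exchange-N*M-∈ {i} i∈X u with V.lookup X u in u∈X
  ... | true  = begin
    (exchange X N *ₘ M) u i ≡⟨ exchange-*ₘ-∈ X N M u∈X i ⟩
    (N *[ X ] M) u i        ≡⟨ *[]-congˡ X N Q M (λ w w∈X → N-XX u∈X w∈X) i ⟩
    (Q *[ X ] M) u i        ≡⟨ Q*M≡δ u∈X i∈X ⟩
    δ u i                   ∎
    where open ≡-Reasoning
  ... | false = begin
    (exchange X N *ₘ M) u i
      ≡⟨ exchange-*ₘ-∉ X N M u∈X i ⟩
    (N *[ X ] M) u i xor M u i
      ≡⟨ cong (_xor M u i) (*[]-congˡ X N (M *[ X ] Q) M (λ w w∈X → N-YX u∈X w∈X) i) ⟩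
    ((M *[ X ] Q) *[ X ] M) u i xor M u i
      ≡⟨ cong (_xor M u i) (*[]-assoc M Q M X u i) ⟩
    (M *[ X ] (Q *[ X ] M)) u i xor M u i
      ≡⟨ cong (_xor M u i) (*[]-δʳ X M (Q *[ X ] M) i∈X (λ w w∈X → Q*M≡δ w∈X i∈X) u) ⟩
    M u i xor M u i
      ≡⟨ xor-same (M u i) ⟩
    false
      ≡⟨ δ-≢ (∈-∉-distinct X i∈X u∈X ∘ sym) ⟨
    δ u i ∎
    where open ≡-Reasoning

  Φ Ψ : Vector Bool n → Vector Bool n
  Φ x = x · exchange X M
  Ψ y = y · exchange X N

  Φ·N-∈ : (x : Vector Bool n) {i : Fin n} → V.lookup X i ≡ true → (Φ x · N) i ≡ x i
  Φ·N-∈ x {i} i∈X = begin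
    (Φ x · N) i                 ≡⟨ ·-assoc x (exchange X M) N i ⟩
    (x · (exchange X M *ₘ N)) i ≡⟨ ·-congʳ x (exchange X M *ₘ N) δ (exchange-M*N-∈ i∈X) ⟩
    (x · δ) i                   ≡⟨ ·-δ x i ⟩
    x i                         ∎
    where open ≡-Reasoning

  Φ·N-∉ : (x : Vector Bool n) {i : Fin n} → V.lookup X i ≡ false → (Φ x · N) i ≡ (x · M) i
  Φ·N-∉ x {i} i∉X = ≡-trans (·-assoc x (exchange X M) N i)
                            (·-congʳ x (exchange X M *ₘ N) M (exchange-M*N-∉ i∉X))

  Ψ∘Φ : (x : Vector Bool n) → Ψ (Φ x) ≗ x
  Ψ∘Φ x i = by-membership (V.lookup X i) refl
    where
    by-membership : ∀ b → V.lookup X i ≡ b → Ψ (Φ x) i ≡ x i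
    by-membership true  i∈X = ≡-trans (exchange-apply-∈ X N (Φ x) i∈X) (Φ·N-∈ x i∈X)
    by-membership false i∉X = ≡-trans (exchange-apply-∉ X N (Φ x) i∉X) (exchange-apply-∉ X M x i∉X)

  Φ∘Ψ : (y : Vector Bool n) → Φ (Ψ y) ≗ y
  Φ∘Ψ y i = by-membership (V.lookup X i) refl
    where
    by-membership : ∀ b → V.lookup X i ≡ b → Φ (Ψ y) i ≡ y i
    by-membership true  i∈X = begin
      (Ψ y · exchange X M) i      ≡⟨ exchange-apply-∈ X M (Ψ y) i∈X ⟩
      (Ψ y · M) i                 ≡⟨ ·-assoc y (exchange X N) M i ⟩
      (y · (exchange X N *ₘ M)) i ≡⟨ ·-congʳ y (exchange X N *ₘ M) δ (exchange-N*M-∈ i∈X) ⟩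
      (y · δ) i                   ≡⟨ ·-δ y i ⟩
      y i                         ∎
      where open ≡-Reasoning
    by-membership false i∉X = ≡-trans (exchange-apply-∉ X M (Ψ y) i∉X) (exchange-apply-∉ X N y i∉X)

  φ ψ : Subset n → Subset n
  φ x = V.tabulate (Φ (V.lookup x))
  ψ y = V.tabulate (Ψ (V.lookup y))

  ψ∘φ : ∀ x → ψ (φ x) ≡ x
  ψ∘φ x = ≡-trans (V.tabulate-cong inverted) (V.tabulate∘lookup x)
    where
    inverted : Ψ (V.lookup (φ x)) ≗ V.lookup x
    inverted i = ≡-trans (·-congˡ (V.lookup∘tabulate (Φ (V.lookup x))) (exchange X N) i)
                         (Ψ∘Φ (V.lookup x) i)

  φ∘ψ : ∀ y → φ (ψ y) ≡ y
  φ∘ψ y = ≡-trans (V.tabulate-cong inverted) (V.tabulate∘lookup y)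
    where
    inverted : Φ (V.lookup (ψ y)) ≗ V.lookup y
    inverted i = ≡-trans (·-congˡ (V.lookup∘tabulate (Ψ (V.lookup y))) (exchange X M) i)
                         (Φ∘Ψ (V.lookup y) i)

  inKernel-φ : (Z x : Subset n) → inKernel M Z x ≡ inKernel N (Z ⊕ X) (φ x)
  inKernel-φ Z x = begin
    inKernel M Z x
      ≡⟨ inKernel-pointwise M Z x ⟩
    ⋀.sum (λ i → kernelAt (x′ i) (V.lookup Z i) ((x′ · M) i))
      ≡⟨ ⋀.sum-cong-≗ exchanged ⟩
    ⋀.sum (λ i → kernelAt (Φ x′ i) (V.lookup Z i xor V.lookup X i) ((Φ x′ · N) i))
      ≡⟨ ⋀.sum-cong-≗ (λ i → kernelAt-cong (sym (V.lookup∘tabulate (Φ x′) i))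
                                            (sym (V.lookup-zipWith _xor_ i Z X))
                                            (·-congˡ (sym ∘ V.lookup∘tabulate (Φ x′)) N i)) ⟩
    ⋀.sum (λ i → kernelAt (V.lookup (φ x) i) (V.lookup (Z ⊕ X) i) ((V.lookup (φ x) · N) i))
      ≡⟨ inKernel-pointwise N (Z ⊕ X) (φ x) ⟨
    inKernel N (Z ⊕ X) (φ x) ∎
    where
    open ≡-Reasoning
    x′ = V.lookup x
    exchanged : ∀ i → kernelAt (x′ i) (V.lookup Z i) ((x′ · M) i)
                    ≡ kernelAt (Φ x′ i) (V.lookup Z i xor V.lookup X i) ((Φ x′ · N) i)
    exchanged i = by-membership (V.lookup X i) refl
      where
      by-membership : ∀ b → V.lookup X i ≡ b → kernelAt (x′ i) (V.lookup Z i) ((x′ · M) i)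
                                               ≡ kernelAt (Φ x′ i) (V.lookup Z i xor b) ((Φ x′ · N) i)
      by-membership true  i∈X = ≡-trans (kernelAt-swap (x′ i) (V.lookup Z i) ((x′ · M) i))
        (sym (kernelAt-cong (exchange-apply-∈ X M x′ i∈X) (xor-comm (V.lookup Z i) true) (Φ·N-∈ x′ i∈X)))
      by-membership false i∉X =
        sym (kernelAt-cong (exchange-apply-∉ X M x′ i∉X) (xor-identityʳ (V.lookup Z i)) (Φ·N-∉ x′ i∉X))

  kernelCount-pivot : (A : Subset n) → kernelCount N A ≡ kernelCount M (A ⊕ X)
  kernelCount-pivot A = begin
    count (inKernel N A) U             ≡⟨ cong (λ B → count (inKernel N B) U) (⊕-cancelʳ A X) ⟨
    count (inKernel N (Z ⊕ X)) U       ≡⟨ count-bijection φ ψ ψ∘φ φ∘ψ (inKernel N (Z ⊕ X)) ⟨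
    count (inKernel N (Z ⊕ X) ∘ φ) U   ≡⟨ count-cong (sym ∘ inKernel-φ Z) U ⟩
    count (inKernel M Z) U             ∎
    where
    open ≡-Reasoning
    U = allSubsets n
    Z = A ⊕ X

Pδ-exponent : Mat n → Subset n → ℕ
Pδ-exponent M A = rankPrincipal M A + rankPrincipal M (complement A)

Pδ-exponent-translate : (M N : Mat n) (X : Subset n) → (∀ A → kernelCount N A ≡ kernelCount M (A ⊕ X)) →
  ∀ A → Pδ-exponent N A ≡ Pδ-exponent M (A ⊕ X)
Pδ-exponent-translate {n} M N X same-kernels A = +-cancelˡ-≡ n _ _ (begin
  n + Pδ-exponent N A
    ≡⟨ cong (_+ Pδ-exponent N A) (size-complement-⊕ A X) ⟨
  size (A ⊕ X) + size (Aᶜ ⊕ X) + Pδ-exponent N A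
    ≡⟨ +-comm (size (A ⊕ X) + size (Aᶜ ⊕ X)) (Pδ-exponent N A) ⟩
  Pδ-exponent N A + (size (A ⊕ X) + size (Aᶜ ⊕ X))
    ≡⟨ +-interchange (rankPrincipal N A) _ _ _ ⟩
  (rankPrincipal N A + size (A ⊕ X)) + (rankPrincipal N Aᶜ + size (Aᶜ ⊕ X))
    ≡⟨ cong₂ _+_ (nullity A) (nullity Aᶜ) ⟩
  (size A + rankPrincipal M (A ⊕ X)) + (size Aᶜ + rankPrincipal M (Aᶜ ⊕ X))
    ≡⟨ +-interchange (size A) _ _ _ ⟩
  (size A + size Aᶜ) + (rankPrincipal M (A ⊕ X) + rankPrincipal M (Aᶜ ⊕ X))
    ≡⟨ cong₂ _+_ (size-complement A)
                 (cong (λ B → rankPrincipal M (A ⊕ X) + rankPrincipal M B) (sym (complement-⊕ A X))) ⟩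
  n + Pδ-exponent M (A ⊕ X) ∎)
  where
  open ≡-Reasoning
  Aᶜ = complement A
  nullity : ∀ B → rankPrincipal N B + size (B ⊕ X) ≡ size B + rankPrincipal M (B ⊕ X)
  nullity B = equal-kernels⇒equal-nullity M N B (B ⊕ X) (same-kernels B)

Pδ-translate : (M N : Mat n) (X : Subset n) → (∀ A → Pδ-exponent N A ≡ Pδ-exponent M (A ⊕ X)) →
  ∀ k → Pδ M k ≡ Pδ N k
Pδ-translate {n} M N X exponents k = begin
  length (filter (λ A → Pδ-exponent M A ≟ k) U)
    ≡⟨ length-filter≡count (λ A → Pδ-exponent M A ≟ k) U ⟩
  count (λ A → does (Pδ-exponent M A ≟ k)) U
    ≡⟨ count-bijection (_⊕ X) (_⊕ X) (λ A → ⊕-cancelʳ A X) (λ A → ⊕-cancelʳ A X) _ ⟨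
  count (λ A → does (Pδ-exponent M (A ⊕ X) ≟ k)) U
    ≡⟨ count-cong (λ A → cong (λ r → does (r ≟ k)) (exponents A)) U ⟨
  count (λ A → does (Pδ-exponent N A ≟ k)) U
    ≡⟨ length-filter≡count (λ A → Pδ-exponent N A ≟ k) U ⟨
  length (filter (λ A → Pδ-exponent N A ≟ k) U) ∎
  where
  open ≡-Reasoning
  U = allSubsets n

corollary5p3 : (n : ℕ) (G G' : Graft n) (X : Subset n) (Pinv : Mat n) →
    IsInverseOn X (adjMatrix G) Pinv →
    (∀ u v → adjMatrix G' u v ≡ pivot (adjMatrix G) X Pinv u v) →
    ∀ k → Pδ (adjMatrix G) k ≡ Pδ (adjMatrix G') k
corollary5p3 n G G' X Pinv inverse G'≡pivot =
  Pδ-translate M N X (Pδ-exponent-translate M N X kernelCount-pivot)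
  where
  M = adjMatrix G
  N = adjMatrix G'
  open Pivot M N Pinv X inverse G'≡pivot using (kernelCount-pivot)
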